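{- If a matroid $M$ is a minor of a matroid $M'$, then $\mathrm{c^*d}(M)\le \mathrm{c^*d}(M')\le \mathrm{cd}(M')$, where $\mathrm{c^*d}$ denotes c$^*$-depth and $\mathrm{cd}$ denotes c-depth.
   Context: A component of a matroid is an inclusion-wise maximal set of elements any two of which lie in a common circuit; $M$ is connected if it has one component. $M'$ is a c$^*$-transformation of $M$ if there are a matroid $M^+$ and $f\in E(M^+)$ with $M=M^+\setminus f$ and $M'=M^+/f$. The c-depth (resp. c$^*$-depth) of $M$ is: $1$ if $|E(M)|\le1$; the maximum over the restrictions of $M$ to its components if $M$ is not connected; and if $M$ is connected, $1+$ the minimum c-depth of $M/e$ over $e\in E(M)$ (resp. $1+$ the minimum c$^*$-depth of a c$^*$-transformation $M''\neq M$ of $M$). -}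

module Defs where

open import Data.Nat using (ℕ; zero; suc; _≤_; _<_)
open import Data.Bool using (Bool; true; false; if_then_else_)
open import Data.Fin using (Fin; punchIn)
open import Data.Fin.Subset using (Subset; ⊥; ⁅_⁆; _∈_; _∉_; _⊆_; _⊂_; _∪_; ∣_∣)
open import Data.Product using (Σ; ∃; ∃-syntax; _×_; _,_)
open import Relation.Binary.PropositionalEquality using (_≡_; _≢_)
open import Relation.Nullary using (¬_)
open import Function.Definitions using (Injective)

record Matroid (n : ℕ) : Set where
  field
    ind       : Subset n → Bool
    ind-empty : ind ⊥ ≡ true
    ind-down  : ∀ X Y → X ⊆ Y → ind Y ≡ true → ind X ≡ true
    ind-aug   : ∀ X Y → ind X ≡ true → ind Y ≡ true → ∣ X ∣ < ∣ Y ∣ →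
                ∃[ y ] (y ∈ Y × y ∉ X × ind (X ∪ ⁅ y ⁆) ≡ true)
open Matroid public

Img : ∀ {m n} → (Fin m → Fin n) → Subset m → Subset n → Set
Img g X Y = ∀ x → ((x ∈ Y → ∃[ i ] (i ∈ X × g i ≡ x)) × (∃[ i ] (i ∈ X × g i ≡ x) → x ∈ Y))

SameMatroid : ∀ {n} → Matroid n → Matroid n → Set
SameMatroid M N = ∀ X → ind M X ≡ ind N X

IsCircuit : ∀ {n} → Matroid n → Subset n → Set
IsCircuit M C = ind M C ≡ false × (∀ D → D ⊂ C → ind M D ≡ true)

CircuitClique : ∀ {n} → Matroid n → Subset n → Set
CircuitClique M C = ∀ x y → x ∈ C → y ∈ C → x ≢ y →
                    ∃[ D ] (IsCircuit M D × x ∈ D × y ∈ D)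

IsComponent : ∀ {n} → Matroid n → Subset n → Set
IsComponent M C = CircuitClique M C × (∀ D → CircuitClique M D → C ⊆ D → D ≡ C)

Connected : ∀ {n} → Matroid n → Set
Connected M = ∃[ C ] (IsComponent M C × (∀ D → IsComponent M D → D ≡ C))

-- N (on Fin m) is the restriction M|C, with its ground set identified with C via g.
IsRestriction : ∀ {n m} → Matroid n → Subset n → Matroid m → Set
IsRestriction {n} {m} M C N =
  Σ (Fin m → Fin n) λ g → Injective _≡_ _≡_ g ×
    (∀ x → ((x ∈ C → ∃[ i ] (g i ≡ x)) × (∃[ i ] (g i ≡ x) → x ∈ C))) ×
    (∀ X Y → Img g X Y → ind N X ≡ ind M Y)

-- N = M \ f, the ground set E(M) - f identified with Fin n via punchIn f.
IsDeletion : ∀ {n} → Matroid (suc n) → Fin (suc n) → Matroid n → Set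
IsDeletion M f N = ∀ X Y → Img (punchIn f) X Y → ind N X ≡ ind M Y

-- N = M / f: if f is a loop, M / f = M \ f; otherwise I is independent in M / f
-- iff I ∪ {f} is independent in M.
IsContraction : ∀ {n} → Matroid (suc n) → Fin (suc n) → Matroid n → Set
IsContraction M f N = ∀ X Y → Img (punchIn f) X Y →
  ind N X ≡ (if ind M ⁅ f ⁆ then ind M (Y ∪ ⁅ f ⁆) else ind M Y)

IsCStarTransformation : ∀ {n} → Matroid n → Matroid n → Set
IsCStarTransformation {n} M M'' =
  Σ (Matroid (suc n)) λ M⁺ → Σ (Fin (suc n)) λ f → IsDeletion M⁺ f M × IsContraction M⁺ f M''

Isomorphic : ∀ {n} → Matroid n → Matroid n → Set
Isomorphic {n} M N = Σ (Fin n → Fin n) λ σ → Injective _≡_ _≡_ σ ×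
  (∀ X Y → Img σ X Y → ind M X ≡ ind N Y)

data Minor {m : ℕ} (M : Matroid m) : {n : ℕ} → Matroid n → Set where
  minor-iso : ∀ {M' : Matroid m} → Isomorphic M M' → Minor M M'
  minor-del : ∀ {n} {M' : Matroid (suc n)} (f : Fin (suc n)) (N : Matroid n) →
              IsDeletion M' f N → Minor M N → Minor M M'
  minor-con : ∀ {n} {M' : Matroid (suc n)} (f : Fin (suc n)) (N : Matroid n) →
              IsContraction M' f N → Minor M N → Minor M M'

-- CdLe M k  :⇔  c-depth(M) ≤ k   (the recursive definition, unfolded: min ↦ ∃, max ↦ ∀).
data CdLe : {n : ℕ} → Matroid n → ℕ → Set where
  cd-small : ∀ {n} {M : Matroid n} {k} → n ≤ 1 → 1 ≤ k → CdLe M k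
  cd-disc  : ∀ {n} {M : Matroid n} {k} → 2 ≤ n → ¬ Connected M →
             (∀ C → IsComponent M C → ∀ m (N : Matroid m) → IsRestriction M C N → CdLe N k) →
             CdLe M k
  cd-conn  : ∀ {n} {M : Matroid (suc n)} {k} → 1 ≤ n → Connected M →
             (e : Fin (suc n)) (N : Matroid n) → IsContraction M e N → CdLe N k →
             CdLe M (suc k)

data CsdLe : {n : ℕ} → Matroid n → ℕ → Set where
  csd-small : ∀ {n} {M : Matroid n} {k} → n ≤ 1 → 1 ≤ k → CsdLe M k
  csd-disc  : ∀ {n} {M : Matroid n} {k} → 2 ≤ n → ¬ Connected M →
              (∀ C → IsComponent M C → ∀ m (N : Matroid m) → IsRestriction M C N → CsdLe N k) →
              CsdLe M k
  csd-conn  : ∀ {n} {M : Matroid n} {k} → 2 ≤ n → Connected M →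
              (M'' : Matroid n) → IsCStarTransformation M M'' → ¬ SameMatroid M'' M →
              CsdLe M'' k → CsdLe M (suc k)

-- (1) c*-depth is minor-monotone, by induction on the c*-depth derivation of M′.  Components of a
-- disconnected minor are smaller minors, so only connected minors M matter.  If M′ is disconnected,
-- circuit-cliques of a deletion or contraction lift to circuit-cliques of the original matroid, so M
-- lies in one component K and is a minor of M′|K.  If M′ = M⁺ \ f is connected with c*-transformation
-- M″ = M⁺ / f, then, deletions and contractions of distinct elements commuting, the operations that
-- produce M from M′ applied to M⁺ give a c*-transformation M₀ of M which is a minor of M″; either
-- M₀ = M or M₀ is a legal step of the c*-depth recursion for M.  The only non-formal commutation is
-- (M / a) / b = (M / b) / a for parallel a, b, where P ∪ a is independent iff P ∪ b is.
--
-- (2) c*-depth ≤ c-depth: if M is connected and cd(M / e) ≤ k, add an element e′ parallel to e.  Then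
-- M is the deletion of e′ and the contraction M″ of e′ has e as a loop and M″ \ e = M / e; so M″ ≠ M
-- is disconnected, its components are {e} and restrictions of M / e, and (1) bounds their c*-depth.

module Submission where

open import Defs
open import Data.Bool using (Bool; true; false; if_then_else_; not; _∧_)
open import Data.Bool.Properties using (¬-not; not-¬; if-cong; if-cong₂) renaming (_≟_ to _≟ᵇ_)
open import Data.Fin using (Fin; zero; suc; punchIn; punchOut; inject≤; fromℕ<; _≟_)
import Data.Fin.Properties as Finₚ
open import Data.Fin.Subset
open import Data.Fin.Subset.Induction using (⊂-wellFounded; ⊃-wellFounded; Acc; acc)
open import Data.Fin.Subset.Properties
open import Data.Nat using (ℕ; zero; suc; _≤_; _<_; z≤n; s≤s; _≤?_)
open import Data.Nat.Induction using (<-wellFounded)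
import Data.Nat.Properties as ℕₚ
open import Data.Product using (Σ; ∃-syntax; _×_; _,_; proj₁; proj₂)
import Data.Product as Product
open import Data.Sum using (_⊎_; inj₁; inj₂; [_,_]′)
import Data.Sum as Sum
open import Data.Vec using (_∷_; []; here; there; lookup; tabulate)
open import Data.Vec.Properties using ([]=⇒lookup; lookup⇒[]=; lookup∘tabulate)
open import Function using (_∘_; id)
open import Function.Definitions using (Injective)
open import Relation.Binary.PropositionalEquality
  using (_≡_; _≢_; refl; sym; trans; cong; cong₂; subst; subst₂; module ≡-Reasoning)
open import Relation.Nullary using (¬_; Dec; yes; no; ¬?; does)
open import Relation.Nullary.Decidable using (_×-dec_; _⊎-dec_; _→-dec_; dec-true; decidable-stable)
open import Relation.Nullary.Negation using (contradiction)
open import Relation.Unary using (Decidable)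

private variable
  m n p q : ℕ

x∈p∪⁅y⁆⁻ : ∀ {x y : Fin n} (p : Subset n) → x ∈ p ∪ ⁅ y ⁆ → x ∈ p ⊎ x ≡ y
x∈p∪⁅y⁆⁻ {y = y} p x∈ = Sum.map₂ (x∈⁅y⁆⇒x≡y y) (x∈p∪q⁻ p ⁅ y ⁆ x∈)

y∈p∪⁅y⁆ : ∀ (p : Subset n) (y : Fin n) → y ∈ p ∪ ⁅ y ⁆
y∈p∪⁅y⁆ p y = q⊆p∪q p ⁅ y ⁆ (x∈⁅x⁆ y)

x∈p─q⇒x∉q : ∀ {x : Fin n} (p q : Subset n) → x ∈ p ─ q → x ∉ q
x∈p─q⇒x∉q (_ ∷ p) (inside  ∷ q) (there x∈) (there x∈q) = x∈p─q⇒x∉q p q x∈ x∈q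
x∈p─q⇒x∉q (_ ∷ p) (outside ∷ q) (there x∈) (there x∈q) = x∈p─q⇒x∉q p q x∈ x∈q

x∈p─q⁻ : ∀ {x : Fin n} (p q : Subset n) → x ∈ p ─ q → x ∈ p × x ∉ q
x∈p─q⁻ p q x∈ = p─q⊆p p q x∈ , x∈p─q⇒x∉q p q x∈

x∈p-y⁻ : ∀ {x y : Fin n} (p : Subset n) → x ∈ p - y → x ∈ p × x ≢ y
x∈p-y⁻ p x∈ = Product.map₂ x∉⁅y⁆⇒x≢y (x∈p─q⁻ p _ x∈)

p⊆p-x∪⁅x⁆ : ∀ (p : Subset n) (x : Fin n) → p ⊆ (p - x) ∪ ⁅ x ⁆
p⊆p-x∪⁅x⁆ p x {y} y∈p with y ≟ x
... | yes refl = y∈p∪⁅y⁆ (p - x) y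
... | no y≢x   = p⊆p∪q _ (x∈p∧x≢y⇒x∈p-y y∈p y≢x)

x∈p∪q∧x∉p⇒x∈q : ∀ {x : Fin n} (p q : Subset n) → x ∈ p ∪ q → x ∉ p → x ∈ q
x∈p∪q∧x∉p⇒x∈q p q x∈ x∉p = [ (λ x∈p → contradiction x∈p x∉p) , id ]′ (x∈p∪q⁻ p q x∈)

x∈p∪q∧x∉q⇒x∈p : ∀ {x : Fin n} (p q : Subset n) → x ∈ p ∪ q → x ∉ q → x ∈ p
x∈p∪q∧x∉q⇒x∈p p q x∈ x∉q = [ id , (λ x∈q → contradiction x∈q x∉q) ]′ (x∈p∪q⁻ p q x∈)

p⊆q-x⇒x∉p : ∀ {p q : Subset n} {x} → p ⊆ q - x → x ∉ p
p⊆q-x⇒x∉p {q = q} p⊆q-x x∈p = proj₂ (x∈p-y⁻ q (p⊆q-x x∈p)) refl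

∄⇒⊆ : ∀ {p q : Subset n} → ¬ (∃[ x ] (x ∈ p × x ∉ q)) → p ⊆ q
∄⇒⊆ {q = q} ∄x {x} x∈p with x ∈? q
... | yes x∈q = x∈q
... | no  x∉q = contradiction (x , x∈p , x∉q) ∄x

⊂⁺ : ∀ {p q : Subset n} {x} → p ⊆ q → x ∈ q → x ∉ p → p ⊂ q
⊂⁺ p⊆q x∈q x∉p = p⊆q , _ , x∈q , x∉p

x∈p⇒⁅x⁆⊆p : ∀ {p : Subset n} {x} → x ∈ p → ⁅ x ⁆ ⊆ p
x∈p⇒⁅x⁆⊆p {p = p} {x} x∈p y∈ = subst (_∈ p) (sym (x∈⁅y⁆⇒x≡y x y∈)) x∈p

∪-monoˡ-⊆ : ∀ {p q : Subset n} (r : Subset n) → p ⊆ q → p ∪ r ⊆ q ∪ r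
∪-monoˡ-⊆ {p = p} {q} r p⊆q x∈ = [ p⊆p∪q r ∘ p⊆q , q⊆p∪q q r ]′ (x∈p∪q⁻ p r x∈)

∣p∪⁅x⁆∣≡1+∣p∣ : ∀ (p : Subset n) (x : Fin n) → x ∉ p → ∣ p ∪ ⁅ x ⁆ ∣ ≡ suc ∣ p ∣
∣p∪⁅x⁆∣≡1+∣p∣ (inside  ∷ p) zero    x∉p = contradiction here x∉p
∣p∪⁅x⁆∣≡1+∣p∣ (outside ∷ p) zero    x∉p = cong (suc ∘ ∣_∣) (∪-identityʳ p)
∣p∪⁅x⁆∣≡1+∣p∣ (inside  ∷ p) (suc x) x∉p = cong suc (∣p∪⁅x⁆∣≡1+∣p∣ p x (x∉p ∘ there))
∣p∪⁅x⁆∣≡1+∣p∣ (outside ∷ p) (suc x) x∉p = ∣p∪⁅x⁆∣≡1+∣p∣ p x (x∉p ∘ there)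

p⊆q∧∣q∣≤∣p∣⇒q⊆p : ∀ {p q : Subset n} → p ⊆ q → ∣ q ∣ ≤ ∣ p ∣ → q ⊆ p
p⊆q∧∣q∣≤∣p∣⇒q⊆p p⊆q ∣q∣≤∣p∣ = ∄⇒⊆ λ (_ , x∈q , x∉p) → ℕₚ.<⇒≱ (p⊂q⇒∣p∣<∣q∣ (⊂⁺ p⊆q x∈q x∉p)) ∣q∣≤∣p∣

∪-swapʳ : ∀ (p q r : Subset n) → (p ∪ q) ∪ r ≡ (p ∪ r) ∪ q
∪-swapʳ p q r = trans (∪-assoc p q r) (trans (cong (p ∪_) (∪-comm q r)) (sym (∪-assoc p r q)))

subsetOf : ∀ {P : Fin n → Set} → Decidable P → Subset n
subsetOf P? = tabulate (does ∘ P?)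

∈-subsetOf⁺ : ∀ {P : Fin n → Set} (P? : Decidable P) {x} → P x → x ∈ subsetOf P?
∈-subsetOf⁺ P? {x} px = lookup⇒[]= x (subsetOf P?) (trans (lookup∘tabulate (does ∘ P?) x) (dec-true (P? x) px))

∈-subsetOf⁻ : ∀ {P : Fin n → Set} (P? : Decidable P) {x} → x ∈ subsetOf P? → P x
∈-subsetOf⁻ P? {x} x∈ with P? x | trans (sym (lookup∘tabulate (does ∘ P?) x)) ([]=⇒lookup x∈)
... | yes px | _  = px
... | no  _  | ()

image : (Fin m → Fin n) → Subset m → Subset n
image {zero}  g []            = ⊥
image {suc m} g (inside  ∷ X) = ⁅ g zero ⁆ ∪ image (g ∘ suc) X
image {suc m} g (outside ∷ X) = image (g ∘ suc) X

∈-image⁻ : ∀ (g : Fin m → Fin n) (X : Subset m) {y} → y ∈ image g X → ∃[ i ] (i ∈ X × g i ≡ y)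
∈-image⁻ {zero}  g []            y∈ = contradiction y∈ ∉⊥
∈-image⁻ {suc m} g (inside  ∷ X) y∈ with x∈p∪q⁻ ⁅ g zero ⁆ (image (g ∘ suc) X) y∈
... | inj₁ y∈⁅g0⁆ = zero , here , sym (x∈⁅y⁆⇒x≡y _ y∈⁅g0⁆)
... | inj₂ y∈rest = Product.map suc (Product.map₁ there) (∈-image⁻ (g ∘ suc) X y∈rest)
∈-image⁻ {suc m} g (outside ∷ X) y∈ = Product.map suc (Product.map₁ there) (∈-image⁻ (g ∘ suc) X y∈)

∈-image⁺ : ∀ (g : Fin m → Fin n) (X : Subset m) {i} → i ∈ X → g i ∈ image g X
∈-image⁺ g (inside  ∷ X) here       = p⊆p∪q (image (g ∘ suc) X) (x∈⁅x⁆ (g zero))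
∈-image⁺ g (inside  ∷ X) (there i∈) = q⊆p∪q ⁅ g zero ⁆ _ (∈-image⁺ (g ∘ suc) X i∈)
∈-image⁺ g (outside ∷ X) (there i∈) = ∈-image⁺ (g ∘ suc) X i∈

∈-image⁺′ : ∀ (g : Fin m → Fin n) (X : Subset m) {i y} → i ∈ X → g i ≡ y → y ∈ image g X
∈-image⁺′ g X i∈ refl = ∈-image⁺ g X i∈

image-mono : ∀ (g : Fin m → Fin n) {X Y : Subset m} → X ⊆ Y → image g X ⊆ image g Y
image-mono g {X} {Y} X⊆Y y∈ =
  let (i , i∈X , gi≡y) = ∈-image⁻ g X y∈ in ∈-image⁺′ g Y (X⊆Y i∈X) gi≡y

image-⊆ : ∀ {g : Fin m → Fin n} {K} → (∀ i → g i ∈ K) → ∀ X → image g X ⊆ K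
image-⊆ {g = g} g∈K X y∈ = let (i , _ , gi≡y) = ∈-image⁻ g X y∈ in subst (_∈ _) gi≡y (g∈K i)

image-⊥ : ∀ (g : Fin m → Fin n) → image g ⊥ ≡ ⊥
image-⊥ g = ⊆-antisym (λ y∈ → contradiction (proj₁ (proj₂ (∈-image⁻ g ⊥ y∈))) ∉⊥) ⊥⊆

image-∪⁅⁆ : ∀ (g : Fin m → Fin n) (X : Subset m) (i : Fin m) → image g (X ∪ ⁅ i ⁆) ≡ image g X ∪ ⁅ g i ⁆
image-∪⁅⁆ g X i = ⊆-antisym ⊆ˡ ⊆ʳ
  where
  ⊆ˡ : image g (X ∪ ⁅ i ⁆) ⊆ image g X ∪ ⁅ g i ⁆
  ⊆ˡ y∈ with ∈-image⁻ g (X ∪ ⁅ i ⁆) y∈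
  ... | j , j∈ , refl with x∈p∪⁅y⁆⁻ X j∈
  ...   | inj₁ j∈X  = p⊆p∪q _ (∈-image⁺ g X j∈X)
  ...   | inj₂ refl = y∈p∪⁅y⁆ (image g X) (g i)
  ⊆ʳ : image g X ∪ ⁅ g i ⁆ ⊆ image g (X ∪ ⁅ i ⁆)
  ⊆ʳ y∈ with x∈p∪⁅y⁆⁻ (image g X) y∈
  ... | inj₁ y∈gX = image-mono g (p⊆p∪q ⁅ i ⁆) y∈gX
  ... | inj₂ refl = ∈-image⁺ g (X ∪ ⁅ i ⁆) (y∈p∪⁅y⁆ X i)

image-⁅⁆ : ∀ (g : Fin m → Fin n) (i : Fin m) → image g ⁅ i ⁆ ≡ ⁅ g i ⁆
image-⁅⁆ g i = begin
  image g ⁅ i ⁆        ≡⟨ cong (image g) (sym (∪-identityˡ ⁅ i ⁆)) ⟩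
  image g (⊥ ∪ ⁅ i ⁆)  ≡⟨ image-∪⁅⁆ g ⊥ i ⟩
  image g ⊥ ∪ ⁅ g i ⁆  ≡⟨ cong (_∪ ⁅ g i ⁆) (image-⊥ g) ⟩
  ⊥ ∪ ⁅ g i ⁆          ≡⟨ ∪-identityˡ ⁅ g i ⁆ ⟩
  ⁅ g i ⁆              ∎
  where open ≡-Reasoning

image-∘ : ∀ (g : Fin m → Fin n) (h : Fin p → Fin m) (X : Subset p) → image (g ∘ h) X ≡ image g (image h X)
image-∘ g h X = ⊆-antisym ⊆ˡ ⊆ʳ
  where
  ⊆ˡ : image (g ∘ h) X ⊆ image g (image h X)
  ⊆ˡ y∈ = let (i , i∈X , ghi≡y) = ∈-image⁻ (g ∘ h) X y∈ in ∈-image⁺′ g _ (∈-image⁺ h X i∈X) ghi≡y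
  ⊆ʳ : image g (image h X) ⊆ image (g ∘ h) X
  ⊆ʳ y∈ with ∈-image⁻ g (image h X) y∈
  ... | j , j∈ , gj≡y with ∈-image⁻ h X j∈
  ...   | i , i∈X , refl = ∈-image⁺′ (g ∘ h) X i∈X gj≡y

image-cong : ∀ {g h : Fin m → Fin n} → (∀ i → g i ≡ h i) → (X : Subset m) → image g X ≡ image h X
image-cong {g = g} {h} g≗h X = ⊆-antisym (⊆ g h g≗h) (⊆ h g (sym ∘ g≗h))
  where
  ⊆ : ∀ g h → (∀ i → g i ≡ h i) → image g X ⊆ image h X
  ⊆ g h g≗h y∈ = let (i , i∈X , gi≡y) = ∈-image⁻ g X y∈ in ∈-image⁺′ h X i∈X (trans (sym (g≗h i)) gi≡y)

image-square : ∀ {g : Fin m → Fin n} {h : Fin p → Fin m} {g′ : Fin q → Fin n} {h′ : Fin p → Fin q} →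
               (∀ i → g (h i) ≡ g′ (h′ i)) → ∀ X → image g (image h X) ≡ image g′ (image h′ X)
image-square {g = g} {h} {g′} {h′} square X =
  trans (sym (image-∘ g h X)) (trans (image-cong square X) (image-∘ g′ h′ X))

image-id : ∀ (X : Subset n) → image id X ≡ X
image-id X = ⊆-antisym (λ y∈ → let (i , i∈X , i≡y) = ∈-image⁻ id X y∈ in subst (_∈ X) i≡y i∈X) (∈-image⁺ id X)

image-punchIn-zero : ∀ (X : Subset n) → image (punchIn zero) X ≡ outside ∷ X
image-punchIn-zero X = ⊆-antisym
  (λ y∈ → let (i , i∈X , suc-i≡y) = ∈-image⁻ suc X y∈ in subst (_∈ outside ∷ X) suc-i≡y (there i∈X))
  (λ { (there i∈X) → ∈-image⁺ suc X i∈X })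

∣image∣≡∣X∣ : ∀ {g : Fin m → Fin n} → Injective _≡_ _≡_ g → (X : Subset m) → ∣ image g X ∣ ≡ ∣ X ∣
∣image∣≡∣X∣ {zero}  {n} inj [] = ∣⊥∣≡0 n
∣image∣≡∣X∣ {suc m} inj (outside ∷ X) = ∣image∣≡∣X∣ (Finₚ.suc-injective ∘ inj) X
∣image∣≡∣X∣ {suc m} {g = g} inj (inside ∷ X) = begin
  ∣ ⁅ g zero ⁆ ∪ image (g ∘ suc) X ∣  ≡⟨ cong ∣_∣ (∪-comm ⁅ g zero ⁆ _) ⟩
  ∣ image (g ∘ suc) X ∪ ⁅ g zero ⁆ ∣  ≡⟨ ∣p∪⁅x⁆∣≡1+∣p∣ _ (g zero) g0∉ ⟩
  suc ∣ image (g ∘ suc) X ∣           ≡⟨ cong suc (∣image∣≡∣X∣ (Finₚ.suc-injective ∘ inj) X) ⟩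
  suc ∣ X ∣                           ∎
  where
  open ≡-Reasoning
  g0∉ : g zero ∉ image (g ∘ suc) X
  g0∉ g0∈ = let (i , _ , g1+i≡g0) = ∈-image⁻ (g ∘ suc) X g0∈ in Finₚ.0≢1+n (sym (inj g1+i≡g0))

Img-image : ∀ (g : Fin m → Fin n) (X : Subset m) → Img g X (image g X)
Img-image g X y = ∈-image⁻ g X , λ (i , i∈X , gi≡y) → ∈-image⁺′ g X i∈X gi≡y

Img⇒≡image : ∀ (g : Fin m → Fin n) (X : Subset m) (Y : Subset n) → Img g X Y → Y ≡ image g X
Img⇒≡image g X Y img = ⊆-antisym
  (λ {y} y∈Y → let (i , i∈X , gi≡y) = proj₁ (img y) y∈Y in ∈-image⁺′ g X i∈X gi≡y)
  (λ {y} y∈ → proj₂ (img y) (∈-image⁻ g X y∈))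

-- Bases, rank, circuits and components

module Properties (M : Matroid n) where

  Independent : Subset n → Set
  Independent X = ind M X ≡ true

  Dependent : Subset n → Set
  Dependent X = ind M X ≡ false

  independent-⊆ : ∀ {X Y} → X ⊆ Y → Independent Y → Independent X
  independent-⊆ = ind-down M _ _

  dependent-⊇ : ∀ {X Y} → X ⊆ Y → Dependent X → Dependent Y
  dependent-⊇ X⊆Y depX = ¬-not (λ indY → not-¬ (independent-⊆ X⊆Y indY) depX)

  circuit-¬independent : ∀ {C} → IsCircuit M C → ¬ Independent C
  circuit-¬independent (depC , _) indC = not-¬ indC depC

  ¬circuit⊂circuit : ∀ {C D} → IsCircuit M C → IsCircuit M D → ¬ (D ⊂ C)
  ¬circuit⊂circuit (_ , minimal) circD D⊂C = circuit-¬independent circD (minimal _ D⊂C)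

  circuit? : ∀ C → Dec (IsCircuit M C)
  circuit? C with ind M C ≟ᵇ false | anySubset? (λ D → D ⊂? C ×-dec ind M D ≟ᵇ false)
  ... | no  indC | _                   = no (indC ∘ proj₁)
  ... | yes _    | yes (D , D⊂C , depD) = no (λ (_ , minimal) → not-¬ (minimal D D⊂C) depD)
  ... | yes depC | no ∄D               = yes (depC , λ D D⊂C → ¬-not (λ depD → ∄D (D , D⊂C , depD)))

  circuit⊆dependent : ∀ {X} → Dependent X → ∃[ C ] (IsCircuit M C × C ⊆ X)
  circuit⊆dependent {X} = go (⊂-wellFounded X)
    where
    go : ∀ {X} → Acc _⊂_ X → Dependent X → ∃[ C ] (IsCircuit M C × C ⊆ X)
    go {X} (acc smaller) depX with anySubset? (λ D → D ⊂? X ×-dec ind M D ≟ᵇ false)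
    ... | yes (D , D⊂X , depD) = let (C , circC , C⊆D) = go (smaller D⊂X) depD in C , circC , proj₁ D⊂X ∘ C⊆D
    ... | no ∄D = X , (depX , λ D D⊂X → ¬-not (λ depD → ∄D (D , D⊂X , depD))) , id

  IsBasis : Subset n → Subset n → Set
  IsBasis X K = Independent K × K ⊆ X × (∀ {x} → x ∈ X → x ∉ K → Dependent (K ∪ ⁅ x ⁆))

  basis-extending : ∀ {J X} → Independent J → J ⊆ X → ∃[ K ] (J ⊆ K × IsBasis X K)
  basis-extending {J} = go (⊃-wellFounded J)
    where
    go : ∀ {J X} → Acc _⊃_ J → Independent J → J ⊆ X → ∃[ K ] (J ⊆ K × IsBasis X K)
    go {J} {X} (acc larger) indJ J⊆X
      with Finₚ.any? (λ x → x ∈? X ×-dec ¬? (x ∈? J) ×-dec ind M (J ∪ ⁅ x ⁆) ≟ᵇ true)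
    ... | no ∄x = J , id , indJ , J⊆X , λ x∈X x∉J → ¬-not (λ indJx → ∄x (_ , x∈X , x∉J , indJx))
    ... | yes (x , x∈X , x∉J , indJx) =
      let (K , Jx⊆K , basis) = go (larger (⊂⁺ (p⊆p∪q ⁅ x ⁆) (y∈p∪⁅y⁆ J x) x∉J)) indJx
                                  (λ y∈ → [ J⊆X , (λ { refl → x∈X }) ]′ (x∈p∪⁅y⁆⁻ J y∈))
      in K , Jx⊆K ∘ p⊆p∪q ⁅ x ⁆ , basis

  basis-maximum : ∀ {X K J} → IsBasis X K → Independent J → J ⊆ X → ∣ J ∣ ≤ ∣ K ∣
  basis-maximum {X} {K} {J} (indK , _ , maximal) indJ J⊆X with ∣ J ∣ ≤? ∣ K ∣
  ... | yes ∣J∣≤∣K∣ = ∣J∣≤∣K∣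
  ... | no  ∣J∣≰∣K∣ =
    let (y , y∈J , y∉K , indKy) = ind-aug M K J indK indJ (ℕₚ.≰⇒> ∣J∣≰∣K∣)
    in contradiction (maximal (J⊆X y∈J) y∉K) (not-¬ indKy)

  basisOf : Subset n → Subset n
  basisOf X = proj₁ (basis-extending {X = X} (ind-empty M) ⊥⊆)

  basisOf-isBasis : ∀ X → IsBasis X (basisOf X)
  basisOf-isBasis X = proj₂ (proj₂ (basis-extending {X = X} (ind-empty M) ⊥⊆))

  rank : Subset n → ℕ
  rank X = ∣ basisOf X ∣

  independent⇒∣∣≤rank : ∀ {X J} → Independent J → J ⊆ X → ∣ J ∣ ≤ rank X
  independent⇒∣∣≤rank = basis-maximum (basisOf-isBasis _)

  rank-basis : ∀ {X K} → IsBasis X K → rank X ≡ ∣ K ∣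
  rank-basis {X} basis@(indK , K⊆X , _) = ℕₚ.≤-antisym
    (basis-maximum basis (proj₁ (basisOf-isBasis X)) (proj₁ (proj₂ (basisOf-isBasis X))))
    (independent⇒∣∣≤rank indK K⊆X)

  rank-mono : ∀ {X Y} → X ⊆ Y → rank X ≤ rank Y
  rank-mono {X} X⊆Y = let (indK , K⊆X , _) = basisOf-isBasis X in independent⇒∣∣≤rank indK (X⊆Y ∘ K⊆X)

  circuit⇒rank-stable : ∀ {C S f} → IsCircuit M C → f ∈ C → C ⊆ S → rank S ≡ rank (S - f)
  circuit⇒rank-stable {C} {S} {f} circC@(_ , minimal) f∈C C⊆S =
    trans (rank-basis basisS) (sym (rank-basis basisS-f))
    where
    C-f⊆S-f : C - f ⊆ S - f
    C-f⊆S-f y∈ = let (y∈C , y≢f) = x∈p-y⁻ C y∈ in x∈p∧x≢y⇒x∈p-y (C⊆S y∈C) y≢f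
    extension = basis-extending (minimal (C - f) (x∈p⇒p-x⊂p f∈C)) C-f⊆S-f
    K = proj₁ extension
    basisS-f : IsBasis (S - f) K
    basisS-f = proj₂ (proj₂ extension)
    basisS : IsBasis S K
    basisS = let (indK , K⊆S-f , maximal) = basisS-f in indK , proj₁ ∘ x∈p-y⁻ S ∘ K⊆S-f , maximal′
      where
      maximal′ : ∀ {x} → x ∈ S → x ∉ K → Dependent (K ∪ ⁅ x ⁆)
      maximal′ {x} x∈S x∉K with x ≟ f
      ... | yes refl = dependent-⊇ (∪-monoˡ-⊆ ⁅ x ⁆ (proj₁ (proj₂ extension)) ∘ p⊆p-x∪⁅x⁆ C x) (proj₁ circC)
      ... | no  x≢f = proj₂ (proj₂ basisS-f) (x∈p∧x≢y⇒x∈p-y x∈S x≢f) x∉K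

  circuit⇒rank-absorbs : ∀ {C S f} → IsCircuit M C → f ∈ C → C ⊆ S ∪ ⁅ f ⁆ → rank (S ∪ ⁅ f ⁆) ≤ rank S
  circuit⇒rank-absorbs {C} {S} {f} circC f∈C C⊆Sf = ℕₚ.≤-trans
    (ℕₚ.≤-reflexive (circuit⇒rank-stable circC f∈C C⊆Sf))
    (rank-mono (λ y∈ → let (y∈Sf , y≢f) = x∈p-y⁻ (S ∪ ⁅ f ⁆) y∈ in
                       [ id , (λ y≡f → contradiction y≡f y≢f) ]′ (x∈p∪⁅y⁆⁻ S y∈Sf)))

  rank-stable⇒circuit : ∀ {S f} → f ∈ S → rank S ≤ rank (S - f) → ∃[ C ] (IsCircuit M C × f ∈ C × C ⊆ S)
  rank-stable⇒circuit {S} {f} f∈S rankS≤ = from-basis (basisOf-isBasis (S - f))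
    where
    from-basis : ∀ {K} → IsBasis (S - f) K → ∃[ C ] (IsCircuit M C × f ∈ C × C ⊆ S)
    from-basis {K} basis@(indK , K⊆S-f , _) = from-dependence (ind M (K ∪ ⁅ f ⁆) ≟ᵇ true)
      where
      Kf⊆S : K ∪ ⁅ f ⁆ ⊆ S
      Kf⊆S y∈ = [ proj₁ ∘ x∈p-y⁻ S ∘ K⊆S-f , (λ { refl → f∈S }) ]′ (x∈p∪⁅y⁆⁻ K y∈)
      f∉K : f ∉ K
      f∉K = p⊆q-x⇒x∉p K⊆S-f
      from-dependence : Dec (Independent (K ∪ ⁅ f ⁆)) → ∃[ C ] (IsCircuit M C × f ∈ C × C ⊆ S)
      from-dependence (yes indKf) = contradiction (begin
        suc ∣ K ∣        ≡⟨ ∣p∪⁅x⁆∣≡1+∣p∣ K f f∉K ⟨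
        ∣ K ∪ ⁅ f ⁆ ∣    ≤⟨ independent⇒∣∣≤rank indKf Kf⊆S ⟩
        rank S          ≤⟨ rankS≤ ⟩
        rank (S - f)    ≡⟨ rank-basis basis ⟩
        ∣ K ∣            ∎) (ℕₚ.n≮n ∣ K ∣)
        where open ℕₚ.≤-Reasoning
      from-dependence (no ¬indKf) with circuit⊆dependent (¬-not ¬indKf)
      ... | C , circC , C⊆Kf with f ∈? C
      ...   | yes f∈C = C , circC , f∈C , Kf⊆S ∘ C⊆Kf
      ...   | no  f∉C = contradiction (independent-⊆ C⊆K indK) (circuit-¬independent circC)
        where
        C⊆K : C ⊆ K
        C⊆K y∈C = x∈p∪q∧x∉q⇒x∈p K ⁅ f ⁆ (C⊆Kf y∈C) (x≢y⇒x∉⁅y⁆ λ { refl → f∉C y∈C })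

  parallel-exchange : ∀ {a b P} → Independent ⁅ b ⁆ → Dependent (⁅ a ⁆ ∪ ⁅ b ⁆) → a ∉ P → b ∉ P →
                      Independent (P ∪ ⁅ a ⁆) → Independent (P ∪ ⁅ b ⁆)
  parallel-exchange {a} {b} {P} indb depab a∉P b∉P indPa =
    independent-⊆ (p⊆q∧∣q∣≤∣p∣⇒q⊆p K⊆Pb ∣Pb∣≤∣K∣) indK
    where
    Q = (P ∪ ⁅ a ⁆) ∪ ⁅ b ⁆
    extension = basis-extending indb (x∈p⇒⁅x⁆⊆p (y∈p∪⁅y⁆ _ b))
    K = proj₁ extension
    basis : IsBasis Q K
    basis = proj₂ (proj₂ extension)
    indK : Independent K
    indK = proj₁ basis
    a∉K : a ∉ K
    a∉K a∈K = not-¬ (independent-⊆ ab⊆K indK) depab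
      where
      ab⊆K : ⁅ a ⁆ ∪ ⁅ b ⁆ ⊆ K
      ab⊆K y∈ = [ x∈p⇒⁅x⁆⊆p a∈K , x∈p⇒⁅x⁆⊆p (proj₁ (proj₂ extension) (x∈⁅x⁆ b)) ]′ (x∈p∪q⁻ ⁅ a ⁆ ⁅ b ⁆ y∈)
    K⊆Pb : K ⊆ P ∪ ⁅ b ⁆
    K⊆Pb {x} x∈K with x∈p∪⁅y⁆⁻ (P ∪ ⁅ a ⁆) (proj₁ (proj₂ basis) x∈K)
    ... | inj₂ refl = y∈p∪⁅y⁆ P x
    ... | inj₁ x∈Pa with x∈p∪⁅y⁆⁻ P x∈Pa
    ...   | inj₁ x∈P  = p⊆p∪q ⁅ b ⁆ x∈P
    ...   | inj₂ refl = contradiction x∈K a∉K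
    ∣Pb∣≤∣K∣ : ∣ P ∪ ⁅ b ⁆ ∣ ≤ ∣ K ∣
    ∣Pb∣≤∣K∣ = subst (_≤ ∣ K ∣) (trans (∣p∪⁅x⁆∣≡1+∣p∣ P a a∉P) (sym (∣p∪⁅x⁆∣≡1+∣p∣ P b b∉P)))
                     (basis-maximum basis indPa (p⊆p∪q ⁅ b ⁆))

  strong-circuit-elimination : ∀ {C₁ C₂ e f} → IsCircuit M C₁ → IsCircuit M C₂ →
    e ∈ C₁ → e ∈ C₂ → f ∈ C₁ → f ∉ C₂ → ∃[ C ] (IsCircuit M C × f ∈ C × C ⊆ (C₁ ∪ C₂) - e)
  strong-circuit-elimination {C₁} {C₂} {e} {f} circ₁ circ₂ e∈C₁ e∈C₂ f∈C₁ f∉C₂ =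
    rank-stable⇒circuit f∈S (begin
      rank S                        ≤⟨ rank-mono S⊆ ⟩
      rank ((T ∪ ⁅ e ⁆) ∪ ⁅ f ⁆)    ≤⟨ circuit⇒rank-absorbs circ₁ f∈C₁ C₁⊆ ⟩
      rank (T ∪ ⁅ e ⁆)              ≤⟨ circuit⇒rank-absorbs circ₂ e∈C₂ C₂⊆ ⟩
      rank T                        ∎)
    where
    open ℕₚ.≤-Reasoning
    S = (C₁ ∪ C₂) - e
    T = S - f
    f≢e : f ≢ e
    f≢e refl = f∉C₂ e∈C₂
    f∈S : f ∈ S
    f∈S = x∈p∧x≢y⇒x∈p-y (p⊆p∪q C₂ f∈C₁) f≢e
    ∈T : ∀ {x} → x ∈ C₁ ∪ C₂ → x ≢ e → x ≢ f → x ∈ T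
    ∈T x∈ x≢e x≢f = x∈p∧x≢y⇒x∈p-y (x∈p∧x≢y⇒x∈p-y x∈ x≢e) x≢f
    ∈Tef : ∀ {x} → x ∈ C₁ ∪ C₂ → x ∈ (T ∪ ⁅ e ⁆) ∪ ⁅ f ⁆
    ∈Tef {x} x∈ with x ≟ f | x ≟ e
    ... | yes refl | _        = y∈p∪⁅y⁆ _ x
    ... | no  _    | yes refl = p⊆p∪q ⁅ f ⁆ (y∈p∪⁅y⁆ T x)
    ... | no  x≢f  | no  x≢e  = p⊆p∪q ⁅ f ⁆ (p⊆p∪q ⁅ e ⁆ (∈T x∈ x≢e x≢f))
    S⊆ : S ⊆ (T ∪ ⁅ e ⁆) ∪ ⁅ f ⁆
    S⊆ = ∈Tef ∘ proj₁ ∘ x∈p-y⁻ _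
    C₁⊆ : C₁ ⊆ (T ∪ ⁅ e ⁆) ∪ ⁅ f ⁆
    C₁⊆ = ∈Tef ∘ p⊆p∪q C₂
    C₂⊆ : C₂ ⊆ T ∪ ⁅ e ⁆
    C₂⊆ {x} x∈C₂ with x ≟ e
    ... | yes refl = y∈p∪⁅y⁆ T x
    ... | no  x≢e  = p⊆p∪q ⁅ e ⁆ (∈T (q⊆p∪q C₁ C₂ x∈C₂) x≢e (λ { refl → f∉C₂ x∈C₂ }))

  infix 4 _≈_
  _≈_ : Fin n → Fin n → Set
  x ≈ y = ∃[ C ] (IsCircuit M C × x ∈ C × y ∈ C)

  ≈-sym : ∀ {x y} → x ≈ y → y ≈ x
  ≈-sym (C , circC , x∈C , y∈C) = C , circC , y∈C , x∈C

  -- Induction on D ─ C.  Eliminating y from C and D gives C₃ ∋ x; if z ∉ C₃, then C₃ meets D ─ C in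
  -- some w, and eliminating w from D and C₃ gives C₄ ∋ z with C₄ ─ C ⊂ D ─ C.
  ≈-trans : ∀ {x y z} → x ≈ y → y ≈ z → x ≢ z → x ≈ z
  ≈-trans {x} {_} {z} (C , circC , x∈C , y∈C) (D , circD , y∈D , z∈D) x≢z =
    go (⊂-wellFounded (D ─ C)) circD y∈C y∈D z∈D
    where
    ∉C⇒∈ : ∀ {E B v e} → E ⊆ (C ∪ B) - e → v ∈ E → v ∉ C → v ∈ B
    ∉C⇒∈ E⊆ v∈E v∉C = x∈p∪q∧x∉p⇒x∈q C _ (p─q⊆p _ _ (E⊆ v∈E)) v∉C
    go : ∀ {D y} → Acc _⊂_ (D ─ C) → IsCircuit M D → y ∈ C → y ∈ D → z ∈ D → x ≈ z
    go {D} {y} (acc smaller) circD y∈C y∈D z∈D with x ∈? D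
    ... | yes x∈D = D , circD , x∈D , z∈D
    ... | no  x∉D with strong-circuit-elimination circC circD y∈C y∈D x∈C x∉D
    ... | C₃ , circC₃ , x∈C₃ , C₃⊆ with z ∈? C₃
    ... | yes z∈C₃ = C₃ , circC₃ , x∈C₃ , z∈C₃
    ... | no  z∉C₃ with Finₚ.any? (λ w → w ∈? C₃ ×-dec ¬? (w ∈? C))
    ... | no ∄w = contradiction (⊂⁺ (∄⇒⊆ ∄w) y∈C (p⊆q-x⇒x∉p C₃⊆)) (¬circuit⊂circuit circC circC₃)
    ... | yes (w , w∈C₃ , w∉C)
      with strong-circuit-elimination circD circC₃ (∉C⇒∈ C₃⊆ w∈C₃ w∉C) w∈C₃ z∈D z∉C₃
    ... | C₄ , circC₄ , z∈C₄ , C₄⊆ with Finₚ.any? (λ c → c ∈? C₄ ×-dec ¬? (c ∈? D))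
    ... | no ∄c = contradiction (⊂⁺ (∄⇒⊆ ∄c) (∉C⇒∈ C₃⊆ w∈C₃ w∉C) (p⊆q-x⇒x∉p C₄⊆))
                                (¬circuit⊂circuit circD circC₄)
    ... | yes (c , c∈C₄ , c∉D) = go (smaller C₄─C⊂D─C) circC₄ c∈C c∈C₄ z∈C₄
      where
      ∉C⇒∈D : ∀ {v} → v ∈ C₄ → v ∉ C → v ∈ D
      ∉C⇒∈D v∈C₄ v∉C = [ id , (λ v∈C₃ → ∉C⇒∈ C₃⊆ v∈C₃ v∉C) ]′ (x∈p∪q⁻ D C₃ (p─q⊆p _ _ (C₄⊆ v∈C₄)))
      c∈C : c ∈ C
      c∈C with c ∈? C
      ... | yes c∈C = c∈C
      ... | no  c∉C = contradiction (∉C⇒∈D c∈C₄ c∉C) c∉D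
      C₄─C⊂D─C : C₄ ─ C ⊂ D ─ C
      C₄─C⊂D─C = ⊂⁺ (λ v∈ → let (v∈C₄ , v∉C) = x∈p─q⁻ C₄ C v∈ in x∈p∧x∉q⇒x∈p─q (∉C⇒∈D v∈C₄ v∉C) v∉C)
                    (x∈p∧x∉q⇒x∈p─q (∉C⇒∈ C₃⊆ w∈C₃ w∉C) w∉C)
                    (p⊆q-x⇒x∉p C₄⊆ ∘ p─q⊆p C₄ C)

  ≈? : ∀ x y → Dec (x ≈ y)
  ≈? x y = anySubset? (λ C → circuit? C ×-dec x ∈? C ×-dec y ∈? C)

  loop-≉ : ∀ {e x} → Dependent ⁅ e ⁆ → x ≢ e → ¬ (e ≈ x)
  loop-≉ {e} loop x≢e (C , (_ , minimal) , e∈C , x∈C) =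
    not-¬ (minimal ⁅ e ⁆ (⊂⁺ (x∈p⇒⁅x⁆⊆p e∈C) x∈C (x≢y⇒x∉⁅y⁆ x≢e))) loop

  component : Fin n → Subset n
  component x = subsetOf (λ y → y ≟ x ⊎-dec ≈? y x)

  ∈-component⁺ : ∀ {x y} → y ≡ x ⊎ y ≈ x → y ∈ component x
  ∈-component⁺ {x} = ∈-subsetOf⁺ (λ y → y ≟ x ⊎-dec ≈? y x)

  ∈-component⁻ : ∀ {x y} → y ∈ component x → y ≡ x ⊎ y ≈ x
  ∈-component⁻ {x} = ∈-subsetOf⁻ (λ y → y ≟ x ⊎-dec ≈? y x)

  x∈component : ∀ x → x ∈ component x
  x∈component x = ∈-component⁺ (inj₁ refl)

  component-clique : ∀ x → CircuitClique M (component x)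
  component-clique x y z y∈ z∈ y≢z with ∈-component⁻ y∈ | ∈-component⁻ z∈
  ... | inj₁ refl | inj₁ refl = contradiction refl y≢z
  ... | inj₁ refl | inj₂ z≈x  = ≈-sym z≈x
  ... | inj₂ y≈x  | inj₁ refl = y≈x
  ... | inj₂ y≈x  | inj₂ z≈x  = ≈-trans y≈x (≈-sym z≈x) y≢z

  clique⊆component : ∀ {S x} → CircuitClique M S → x ∈ S → S ⊆ component x
  clique⊆component {S} {x} clique x∈S {y} y∈S with y ≟ x
  ... | yes y≡x = ∈-component⁺ (inj₁ y≡x)
  ... | no  y≢x = ∈-component⁺ (inj₂ (clique y x y∈S x∈S y≢x))

  component-isComponent : ∀ x → IsComponent M (component x)
  component-isComponent x = component-clique x , λ D clique x⊆D →
    ⊆-antisym (clique⊆component clique (x⊆D (x∈component x))) x⊆D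

  isComponent⇒≡component : ∀ {C x} → IsComponent M C → x ∈ C → C ≡ component x
  isComponent⇒≡component (clique , maximal) x∈C =
    sym (maximal _ (component-clique _) (clique⊆component clique x∈C))

  component-≈-closed : ∀ {C y z} → IsComponent M C → y ∈ C → z ≈ y → z ∈ C
  component-≈-closed isComp y∈C z≈y =
    subst (_ ∈_) (sym (isComponent⇒≡component isComp y∈C)) (∈-component⁺ (inj₂ z≈y))

  clique⇒connected : CircuitClique M ⊤ → Connected M
  clique⇒connected clique = ⊤ , (clique , λ D _ ⊤⊆D → ⊆-antisym ⊆⊤ ⊤⊆D) ,
                            λ D (_ , maximal) → sym (maximal ⊤ clique ⊆⊤)

  connected⇒clique : Connected M → CircuitClique M ⊤
  connected⇒clique (C , _ , unique) x y _ _ x≢y with ∈-component⁻ y∈component-x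
    where
    y∈component-x : y ∈ component x
    y∈component-x = subst (y ∈_) (trans (unique _ (component-isComponent y))
                                        (sym (unique _ (component-isComponent x)))) (x∈component y)
  ... | inj₁ y≡x = contradiction (sym y≡x) x≢y
  ... | inj₂ y≈x = ≈-sym y≈x

  connected? : Dec (Connected M)
  connected? with Finₚ.all? (λ x → Finₚ.all? (λ y → ¬? (x ≟ y) →-dec ≈? x y))
  ... | yes all≈ = yes (clique⇒connected (λ x y _ _ → all≈ x y))
  ... | no ¬all≈ = no (λ conn → ¬all≈ (λ x y → connected⇒clique conn x y ∈⊤ ∈⊤))

  component-misses : ∀ {C} → ¬ Connected M → IsComponent M C → ∃[ x ] (x ∉ C)
  component-misses {C} disconnected (clique , _) with Finₚ.any? (λ x → ¬? (x ∈? C))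
  ... | yes missed = missed
  ... | no ∄x = contradiction (clique⇒connected (λ x y _ _ → clique x y (⊤⊆C ∈⊤) (⊤⊆C ∈⊤))) disconnected
    where
    ⊤⊆C : ⊤ ⊆ C
    ⊤⊆C = ∄⇒⊆ (λ (x , _ , x∉C) → ∄x (x , x∉C))

-- Pullbacks, deletions and contractions

-- Deletions, isomorphisms and restrictions are all pullbacks along injections.
record IsPullback (M : Matroid n) (g : Fin m → Fin n) (N : Matroid m) : Set where
  constructor mkPullback
  field ind-pullback : ∀ X → ind N X ≡ ind M (image g X)
open IsPullback public

indContract : Matroid n → Fin n → Subset n → Bool
indContract M f Y = if ind M ⁅ f ⁆ then ind M (Y ∪ ⁅ f ⁆) else ind M Y

record ContractsTo (M : Matroid (suc n)) (f : Fin (suc n)) (N : Matroid n) : Set where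
  constructor mkContractsTo
  field ind-contract : ∀ X → ind N X ≡ indContract M f (image (punchIn f) X)
open ContractsTo public

IsDeletion⇒IsPullback : ∀ {M : Matroid (suc n)} {f N} → IsDeletion M f N → IsPullback M (punchIn f) N
IsDeletion⇒IsPullback deleted = mkPullback λ X → deleted X _ (Img-image _ X)

IsPullback⇒IsDeletion : ∀ {M : Matroid (suc n)} {f N} → IsPullback M (punchIn f) N → IsDeletion M f N
IsPullback⇒IsDeletion {M = M} pb X Y img = trans (ind-pullback pb X) (cong (ind M) (sym (Img⇒≡image _ X Y img)))

IsContraction⇒ContractsTo : ∀ {M : Matroid (suc n)} {f N} → IsContraction M f N → ContractsTo M f N
IsContraction⇒ContractsTo contracted = mkContractsTo λ X → contracted X _ (Img-image _ X)

ContractsTo⇒IsContraction : ∀ {M : Matroid (suc n)} {f N} → ContractsTo M f N → IsContraction M f N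
ContractsTo⇒IsContraction {f = f} contracted X Y img rewrite Img⇒≡image (punchIn f) X Y img =
  ind-contract contracted X

Isomorphic⇒IsPullback : ∀ {M N : Matroid n} → Isomorphic M N →
                        Σ (Fin n → Fin n) λ σ → Injective _≡_ _≡_ σ × IsPullback N σ M
Isomorphic⇒IsPullback (σ , inj , iso) = σ , inj , mkPullback λ X → iso X _ (Img-image σ X)

IsPullback⇒Isomorphic : ∀ {M N : Matroid n} {σ : Fin n → Fin n} →
                        IsPullback N σ M → Injective _≡_ _≡_ σ → Isomorphic M N
IsPullback⇒Isomorphic {N = N} {σ} pb inj =
  σ , inj , λ X Y img → trans (ind-pullback pb X) (cong (ind N) (sym (Img⇒≡image σ X Y img)))

IsRestriction⇒IsPullback : ∀ {M : Matroid n} {C} {N : Matroid m} → IsRestriction M C N →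
                           ∃[ g ] (Injective _≡_ _≡_ g × (∀ i → g i ∈ C) × IsPullback M g N)
IsRestriction⇒IsPullback (g , inj , onto , restricted) =
  g , inj , (λ i → proj₂ (onto (g i)) (i , refl)) , mkPullback λ X → restricted X _ (Img-image g X)

IsPullback-∘ : ∀ {M : Matroid n} {N : Matroid m} {Q : Matroid p} {g h} →
               IsPullback M g N → IsPullback N h Q → IsPullback M (g ∘ h) Q
IsPullback-∘ {M = M} {g = g} {h} pbN pbQ = mkPullback λ X →
  trans (ind-pullback pbQ X) (trans (ind-pullback pbN (image h X)) (cong (ind M) (sym (image-∘ g h X))))

IsPullback-cong : ∀ {M : Matroid n} {N : Matroid m} {g h} → (∀ i → g i ≡ h i) → IsPullback M g N → IsPullback M h N
IsPullback-cong {M = M} g≗h pb = mkPullback λ X → trans (ind-pullback pb X) (cong (ind M) (image-cong g≗h X))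

ind-pullback-∪⁅⁆ : ∀ {M : Matroid n} {N : Matroid m} {g} → IsPullback M g N →
                   ∀ X i → ind N (X ∪ ⁅ i ⁆) ≡ ind M (image g X ∪ ⁅ g i ⁆)
ind-pullback-∪⁅⁆ {M = M} {g = g} pb X i = trans (ind-pullback pb _) (cong (ind M) (image-∪⁅⁆ g X i))

ind-pullback-⁅⁆ : ∀ {M : Matroid n} {N : Matroid m} {g} → IsPullback M g N → ∀ i → ind N ⁅ i ⁆ ≡ ind M ⁅ g i ⁆
ind-pullback-⁅⁆ {M = M} {g = g} pb i = trans (ind-pullback pb _) (cong (ind M) (image-⁅⁆ g i))

pullback : (M : Matroid n) (g : Fin m → Fin n) → Injective _≡_ _≡_ g → Matroid m
pullback M g inj = record
  { ind       = ind M ∘ image g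
  ; ind-empty = trans (cong (ind M) (image-⊥ g)) (ind-empty M)
  ; ind-down  = λ X Y X⊆Y → ind-down M _ _ (image-mono g X⊆Y)
  ; ind-aug   = augment
  }
  where
  augment : ∀ X Y → ind M (image g X) ≡ true → ind M (image g Y) ≡ true → ∣ X ∣ < ∣ Y ∣ →
            ∃[ y ] (y ∈ Y × y ∉ X × ind M (image g (X ∪ ⁅ y ⁆)) ≡ true)
  augment X Y indX indY ∣X∣<∣Y∣
    with ind-aug M _ _ indX indY (subst₂ _<_ (sym (∣image∣≡∣X∣ inj X)) (sym (∣image∣≡∣X∣ inj Y)) ∣X∣<∣Y∣)
  ... | y , y∈gY , y∉gX , indXy with ∈-image⁻ g Y y∈gY
  ...   | i , i∈Y , refl = i , i∈Y , y∉gX ∘ ∈-image⁺ g X , trans (cong (ind M) (image-∪⁅⁆ g X i)) indXy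

pullback-isPullback : ∀ (M : Matroid n) (g : Fin m → Fin n) (inj : Injective _≡_ _≡_ g) →
                      IsPullback M g (pullback M g inj)
pullback-isPullback M g inj = mkPullback λ _ → refl

IsPullback-factor : ∀ {M : Matroid n} {N : Matroid p} {g : Fin m → Fin n} {h : Fin p → Fin m}
                    (inj : Injective _≡_ _≡_ g) →
                    IsPullback M (g ∘ h) N → IsPullback (pullback M g inj) h N
IsPullback-factor {M = M} {g = g} {h} inj pb =
  mkPullback λ X → trans (ind-pullback pb X) (cong (ind M) (image-∘ g h X))

punchIn-injective′ : ∀ (f : Fin (suc n)) → Injective _≡_ _≡_ (punchIn f)
punchIn-injective′ f = Finₚ.punchIn-injective f _ _

f∉image-punchIn : ∀ (f : Fin (suc n)) X → f ∉ image (punchIn f) X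
f∉image-punchIn f X f∈ = let (i , _ , fi≡f) = ∈-image⁻ (punchIn f) X f∈ in Finₚ.punchInᵢ≢i f i fi≡f

∣image-punchIn∪⁅f⁆∣ : ∀ (f : Fin (suc n)) X → ∣ image (punchIn f) X ∪ ⁅ f ⁆ ∣ ≡ suc ∣ X ∣
∣image-punchIn∪⁅f⁆∣ f X = trans (∣p∪⁅x⁆∣≡1+∣p∣ _ f (f∉image-punchIn f X))
                                (cong suc (∣image∣≡∣X∣ (punchIn-injective′ f) X))

deletion : (M : Matroid (suc n)) → Fin (suc n) → Matroid n
deletion M f = pullback M (punchIn f) (punchIn-injective′ f)

contraction : (M : Matroid (suc n)) → Fin (suc n) → Matroid n
contraction M f = record
  { ind       = indContract M f ∘ image g
  ; ind-empty = empty
  ; ind-down  = down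
  ; ind-aug   = augment
  }
  where
  g = punchIn f
  empty : indContract M f (image g ⊥) ≡ true
  empty rewrite image-⊥ g with ind M ⁅ f ⁆ in indf
  ... | true  = trans (cong (ind M) (∪-identityˡ ⁅ f ⁆)) indf
  ... | false = ind-empty M
  down : ∀ X Y → X ⊆ Y → indContract M f (image g Y) ≡ true → indContract M f (image g X) ≡ true
  down X Y X⊆Y with ind M ⁅ f ⁆
  ... | true  = ind-down M _ _ (∪-monoˡ-⊆ ⁅ f ⁆ (image-mono g X⊆Y))
  ... | false = ind-down M _ _ (image-mono g X⊆Y)
  augment : ∀ X Y → indContract M f (image g X) ≡ true → indContract M f (image g Y) ≡ true → ∣ X ∣ < ∣ Y ∣ →
            ∃[ y ] (y ∈ Y × y ∉ X × indContract M f (image g (X ∪ ⁅ y ⁆)) ≡ true)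
  augment X Y indX indY ∣X∣<∣Y∣ with ind M ⁅ f ⁆
  ... | false = ind-aug (deletion M f) X Y indX indY ∣X∣<∣Y∣
  ... | true with ind-aug M _ _ indX indY
                   (subst₂ _<_ (sym (∣image-punchIn∪⁅f⁆∣ f X)) (sym (∣image-punchIn∪⁅f⁆∣ f Y)) (s≤s ∣X∣<∣Y∣))
  ...   | y , y∈gYf , y∉gXf , indXfy with x∈p∪⁅y⁆⁻ (image g Y) y∈gYf
  ...     | inj₂ refl = contradiction (y∈p∪⁅y⁆ _ y) y∉gXf
  ...     | inj₁ y∈gY with ∈-image⁻ g Y y∈gY
  ...       | i , i∈Y , refl = i , i∈Y , y∉gXf ∘ p⊆p∪q ⁅ f ⁆ ∘ ∈-image⁺ g X , (begin
    ind M (image g (X ∪ ⁅ i ⁆) ∪ ⁅ f ⁆)    ≡⟨ cong (λ Z → ind M (Z ∪ ⁅ f ⁆)) (image-∪⁅⁆ g X i) ⟩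
    ind M ((image g X ∪ ⁅ g i ⁆) ∪ ⁅ f ⁆)  ≡⟨ cong (ind M) (∪-swapʳ _ _ _) ⟩
    ind M ((image g X ∪ ⁅ f ⁆) ∪ ⁅ g i ⁆)  ≡⟨ indXfy ⟩
    true                                  ∎)
    where open ≡-Reasoning

contraction-contractsTo : ∀ (M : Matroid (suc n)) f → ContractsTo M f (contraction M f)
contraction-contractsTo M f = mkContractsTo λ _ → refl

deletion-isDeletion : ∀ (M : Matroid (suc n)) f → IsDeletion M f (deletion M f)
deletion-isDeletion M f = IsPullback⇒IsDeletion (pullback-isPullback M (punchIn f) (punchIn-injective′ f))

contraction-isContraction : ∀ (M : Matroid (suc n)) f → IsContraction M f (contraction M f)
contraction-isContraction M f = ContractsTo⇒IsContraction (contraction-contractsTo M f)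

indContract-pullback : ∀ {C : Matroid (suc n)} {B : Matroid (suc m)} {σ} → IsPullback C σ B →
                       ∀ f Y → indContract B f Y ≡ indContract C (σ f) (image σ Y)
indContract-pullback pb f Y =
  trans (if-cong (ind-pullback-⁅⁆ pb f)) (if-cong₂ _ (ind-pullback-∪⁅⁆ pb Y f) (ind-pullback pb Y))

squeeze : ∀ {g : Fin m → Fin (suc n)} {x} → (∀ i → x ≢ g i) → Fin m → Fin n
squeeze x∉g i = punchOut (x∉g i)

punchIn-squeeze : ∀ {g : Fin m → Fin (suc n)} {x} (x∉g : ∀ i → x ≢ g i) i → punchIn x (squeeze x∉g i) ≡ g i
punchIn-squeeze x∉g i = Finₚ.punchIn-punchOut (x∉g i)

squeeze-injective : ∀ {g : Fin m → Fin (suc n)} {x} (x∉g : ∀ i → x ≢ g i) →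
                    Injective _≡_ _≡_ g → Injective _≡_ _≡_ (squeeze x∉g)
squeeze-injective x∉g inj eq = inj (Finₚ.punchOut-injective (x∉g _) (x∉g _) eq)

image-squeeze : ∀ {g : Fin m → Fin (suc n)} {x} (x∉g : ∀ i → x ≢ g i) X →
                image (punchIn x) (image (squeeze x∉g) X) ≡ image g X
image-squeeze x∉g X = trans (sym (image-∘ _ (squeeze x∉g) X)) (image-cong (punchIn-squeeze x∉g) X)

IsPullback-squeeze : ∀ {M : Matroid (suc n)} {N : Matroid m} {g x} (x∉g : ∀ i → x ≢ g i) →
                     IsPullback M g N → IsPullback (deletion M x) (squeeze x∉g) N
IsPullback-squeeze {x = x} x∉g pb =
  IsPullback-factor (punchIn-injective′ x) (IsPullback-cong (sym ∘ punchIn-squeeze x∉g) pb)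

injective-avoids : ∀ {σ : Fin (suc m) → Fin (suc n)} → Injective _≡_ _≡_ σ → ∀ f i → σ f ≢ σ (punchIn f i)
injective-avoids inj f i σf≡ = Finₚ.punchInᵢ≢i f i (sym (inj σf≡))

IsPullback-contraction : ∀ {C : Matroid (suc n)} {B : Matroid (suc m)} {N : Matroid m} {N′ : Matroid n} {σ}
  (inj : Injective _≡_ _≡_ σ) → IsPullback C σ B → ∀ {f} → ContractsTo B f N → ContractsTo C (σ f) N′ →
  IsPullback N′ (squeeze (injective-avoids inj f)) N
IsPullback-contraction {C = C} {B} {N} {N′} {σ} inj pb {f} contractedB contractedC = mkPullback λ X → begin
  ind N X
    ≡⟨ ind-contract contractedB X ⟩
  indContract B f (image (punchIn f) X)
    ≡⟨ indContract-pullback pb f _ ⟩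
  indContract C (σ f) (image σ (image (punchIn f) X))
    ≡⟨ cong (indContract C (σ f)) (image-∘ σ (punchIn f) X) ⟨
  indContract C (σ f) (image (σ ∘ punchIn f) X)
    ≡⟨ cong (indContract C (σ f)) (image-squeeze avoids X) ⟨
  indContract C (σ f) (image (punchIn (σ f)) (image τ X))
    ≡⟨ ind-contract contractedC (image τ X) ⟨
  ind N′ (image τ X)
    ∎
  where
  open ≡-Reasoning
  avoids = injective-avoids inj f
  τ = squeeze avoids

minor-size : ∀ {M : Matroid m} {M′ : Matroid n} → Minor M M′ → m ≤ n
minor-size (minor-iso _)         = ℕₚ.≤-refl
minor-size (minor-del _ _ _ min) = ℕₚ.m≤n⇒m≤1+n (minor-size min)
minor-size (minor-con _ _ _ min) = ℕₚ.m≤n⇒m≤1+n (minor-size min)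

SameMatroid⇒Minor : ∀ {M M′ : Matroid n} → SameMatroid M M′ → Minor M M′
SameMatroid⇒Minor {M = M} {M′} same = minor-iso (IsPullback⇒Isomorphic {M = M} {M′} pb id)
  where
  pb : IsPullback M′ id M
  pb = mkPullback λ X → trans (same X) (cong (ind M′) (sym (image-id X)))

minor-refl : ∀ {M : Matroid n} → Minor M M
minor-refl = SameMatroid⇒Minor λ _ → refl

minor-pullbackʳ : ∀ {A : Matroid m} {B C : Matroid n} {σ} →
                  Injective _≡_ _≡_ σ → IsPullback C σ B → Minor A B → Minor A C
minor-pullbackʳ {A = A} {B} {C} inj pb (minor-iso iso) =
  let (ρ , ρ-inj , pbA) = Isomorphic⇒IsPullback {M = A} {B} iso
  in minor-iso (IsPullback⇒Isomorphic {M = A} {C} (IsPullback-∘ pb pbA) (ρ-inj ∘ inj))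
minor-pullbackʳ {n = suc _} {C = C} {σ} inj pb (minor-del f N deleted min) =
  minor-del (σ f) (deletion C (σ f)) (deletion-isDeletion C (σ f))
    (minor-pullbackʳ (squeeze-injective avoids (punchIn-injective′ f ∘ inj))
                     (IsPullback-squeeze avoids (IsPullback-∘ pb (IsDeletion⇒IsPullback deleted))) min)
  where avoids = injective-avoids inj f
minor-pullbackʳ {n = suc _} {C = C} {σ} inj pb (minor-con f N contracted min) =
  minor-con (σ f) (contraction C (σ f)) (contraction-isContraction C (σ f))
    (minor-pullbackʳ (squeeze-injective avoids (punchIn-injective′ f ∘ inj))
                     (IsPullback-contraction inj pb (IsContraction⇒ContractsTo contracted)
                                             (contraction-contractsTo C (σ f))) min)
  where avoids = injective-avoids inj f

minor-trans : ∀ {A : Matroid m} {B : Matroid n} {C : Matroid p} → Minor A B → Minor B C → Minor A C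
minor-trans {B = B} {C} A≤B (minor-iso iso) =
  let (σ , inj , pb) = Isomorphic⇒IsPullback {M = B} {C} iso in minor-pullbackʳ inj pb A≤B
minor-trans A≤B (minor-del f N deleted B≤N)    = minor-del f N deleted (minor-trans A≤B B≤N)
minor-trans A≤B (minor-con f N contracted B≤N) = minor-con f N contracted (minor-trans A≤B B≤N)

pullback-sameSize⇒Minor : ∀ {M : Matroid n} {N : Matroid m} {g} →
                          IsPullback M g N → Injective _≡_ _≡_ g → m ≡ n → Minor N M
pullback-sameSize⇒Minor {M = M} {N} pb inj refl = minor-iso (IsPullback⇒Isomorphic {M = N} {M} pb inj)

pullback⇒Minor : ∀ {M : Matroid n} {N : Matroid m} {g} → IsPullback M g N → Injective _≡_ _≡_ g → Minor N M
pullback⇒Minor {zero} pb inj = pullback-sameSize⇒Minor pb inj (ℕₚ.n≤0⇒n≡0 (Finₚ.injective⇒≤ inj))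
pullback⇒Minor {suc n} {M = M} {g = g} pb inj with Finₚ.any? (λ x → Finₚ.all? (λ i → ¬? (x ≟ g i)))
... | yes (x , x∉g) = minor-del x (deletion M x) (deletion-isDeletion M x)
                        (pullback⇒Minor (IsPullback-squeeze x∉g pb) (squeeze-injective x∉g inj))
... | no ∄x = pullback-sameSize⇒Minor pb inj
                (ℕₚ.≤-antisym (Finₚ.injective⇒≤ inj) (Finₚ.injective⇒≤ section-injective))
  where
  hit : ∀ x → ∃[ i ] (g i ≡ x)
  hit x with Finₚ.any? (λ i → g i ≟ x)
  ... | yes hit = hit
  ... | no ∄i = contradiction (x , λ i x≡gi → ∄i (i , sym x≡gi)) ∄x
  section-injective : Injective _≡_ _≡_ (proj₁ ∘ hit)
  section-injective {x} {y} eq = trans (sym (proj₂ (hit x))) (trans (cong g eq) (proj₂ (hit y)))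

IsPullback-through : ∀ {M : Matroid n} {P : Matroid m} {Q : Matroid p} {τ e h} →
                     IsPullback M τ P → IsPullback M e Q → (∀ i → τ (h i) ≡ e i) → IsPullback P h Q
IsPullback-through {M = M} {P} {Q} {τ} {e} {h} pbP pbQ τ∘h≗e = mkPullback λ X → begin
  ind Q X                    ≡⟨ ind-pullback pbQ X ⟩
  ind M (image e X)          ≡⟨ cong (ind M) (image-cong τ∘h≗e X) ⟨
  ind M (image (τ ∘ h) X)    ≡⟨ cong (ind M) (image-∘ τ h X) ⟩
  ind M (image τ (image h X)) ≡⟨ ind-pullback pbP (image h X) ⟨
  ind P (image h X)          ∎
  where open ≡-Reasoning

pullback-through⇒Minor : ∀ {M : Matroid n} {P : Matroid m} {Q : Matroid p} {τ e} →
  IsPullback M τ P → IsPullback M e Q → Injective _≡_ _≡_ e → (∀ i → ∃[ j ] (τ j ≡ e i)) → Minor Q P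
pullback-through⇒Minor {τ = τ} {e} pbP pbQ inj through =
  pullback⇒Minor (IsPullback-through {h = proj₁ ∘ through} pbP pbQ (proj₂ ∘ through)) h-injective
  where
  h-injective : Injective _≡_ _≡_ (proj₁ ∘ through)
  h-injective {i} {j} eq = inj (trans (sym (proj₂ (through i))) (trans (cong τ eq) (proj₂ (through j))))

enumerate : (K : Subset n) → Fin ∣ K ∣ → Fin n
enumerate (inside  ∷ K) zero    = zero
enumerate (inside  ∷ K) (suc i) = suc (enumerate K i)
enumerate (outside ∷ K) i       = suc (enumerate K i)

enumerate-injective : ∀ (K : Subset n) → Injective _≡_ _≡_ (enumerate K)
enumerate-injective (inside  ∷ K) {zero}  {zero}  _  = refl
enumerate-injective (inside  ∷ K) {suc i} {suc j} eq = cong suc (enumerate-injective K (Finₚ.suc-injective eq))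
enumerate-injective (outside ∷ K)                 eq = enumerate-injective K (Finₚ.suc-injective eq)

enumerate-∈ : ∀ (K : Subset n) i → enumerate K i ∈ K
enumerate-∈ (inside  ∷ K) zero    = here
enumerate-∈ (inside  ∷ K) (suc i) = there (enumerate-∈ K i)
enumerate-∈ (outside ∷ K) i       = there (enumerate-∈ K i)

enumerate-onto : ∀ (K : Subset n) {x} → x ∈ K → ∃[ i ] (enumerate K i ≡ x)
enumerate-onto (inside  ∷ K) here       = zero , refl
enumerate-onto (inside  ∷ K) (there x∈) = Product.map suc (cong suc) (enumerate-onto K x∈)
enumerate-onto (outside ∷ K) (there x∈) = Product.map₂ (cong suc) (enumerate-onto K x∈)

restriction : (M : Matroid n) (K : Subset n) → Matroid ∣ K ∣
restriction M K = pullback M (enumerate K) (enumerate-injective K)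

restriction-isPullback : ∀ (M : Matroid n) K → IsPullback M (enumerate K) (restriction M K)
restriction-isPullback M K = pullback-isPullback M (enumerate K) (enumerate-injective K)

restriction-isRestriction : ∀ (M : Matroid n) K → IsRestriction M K (restriction M K)
restriction-isRestriction M K =
  enumerate K , enumerate-injective K , (λ x → enumerate-onto K , λ { (i , refl) → enumerate-∈ K i }) ,
  λ X Y img → cong (ind M) (sym (Img⇒≡image (enumerate K) X Y img))

pullback-inside⇒Minor : ∀ {M : Matroid n} {Q : Matroid m} {e} K → IsPullback M e Q → Injective _≡_ _≡_ e →
                        (∀ i → e i ∈ K) → Minor Q (restriction M K)
pullback-inside⇒Minor {M = M} K pb inj e∈K =
  pullback-through⇒Minor (restriction-isPullback M K) pb inj (enumerate-onto K ∘ e∈K)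

-- Lifting c*-transformations through minors

true⇔true⇒≡ : ∀ {x y : Bool} → (x ≡ true → y ≡ true) → (y ≡ true → x ≡ true) → x ≡ y
true⇔true⇒≡ {false} {false} _   _   = refl
true⇔true⇒≡ {false} {true}  _   y⇒x = y⇒x refl
true⇔true⇒≡ {true}  {false} x⇒y _   = sym (x⇒y refl)
true⇔true⇒≡ {true}  {true}  _   _   = refl

if-nested-comm : ∀ (a b c u v w z : Bool) → (c ≡ true → a ≡ true) → (c ≡ true → b ≡ true) →
                 (a ≡ true → b ≡ true → c ≡ false → v ≡ w) →
                 (if (if a then c else b) then (if a then u else w) else (if a then v else z)) ≡
                 (if (if b then c else a) then (if b then u else v) else (if b then w else z))
if-nested-comm true  true  true  _ _ _ _ _   _   _        = refl
if-nested-comm true  true  false _ _ _ _ _   _   parallel = parallel refl refl refl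
if-nested-comm true  false true  _ _ _ _ _   c⇒b _        = contradiction (c⇒b refl) λ ()
if-nested-comm true  false false _ _ _ _ _   _   _        = refl
if-nested-comm false _     true  _ _ _ _ c⇒a _   _        = contradiction (c⇒a refl) λ ()
if-nested-comm false true  false _ _ _ _ _   _   _        = refl
if-nested-comm false false false _ _ _ _ _   _   _        = refl

-- ind ((M / a) / b) P, for a, b ∉ P.
indContract₂ : Matroid n → Fin n → Fin n → Subset n → Bool
indContract₂ M a b P = if indContract M a ⁅ b ⁆ then indContract M a (P ∪ ⁅ b ⁆) else indContract M a P

indContract₂-comm : ∀ (M : Matroid n) {a b P} → a ∉ P → b ∉ P → indContract₂ M a b P ≡ indContract₂ M b a P
indContract₂-comm M {a} {b} {P} a∉P b∉P = trans
  (cong₂ (λ c u → if (if α then c else β) then (if α then u else w) else (if α then v else z))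
         (cong (ind M) (∪-comm ⁅ b ⁆ ⁅ a ⁆)) (cong (ind M) (∪-swapʳ P ⁅ b ⁆ ⁅ a ⁆)))
  (if-nested-comm α β γ u v w z (independent-⊆ (p⊆p∪q ⁅ b ⁆)) (independent-⊆ (q⊆p∪q ⁅ a ⁆ ⁅ b ⁆)) parallel)
  where
  open Properties M
  α = ind M ⁅ a ⁆
  β = ind M ⁅ b ⁆
  γ = ind M (⁅ a ⁆ ∪ ⁅ b ⁆)
  u = ind M ((P ∪ ⁅ a ⁆) ∪ ⁅ b ⁆)
  v = ind M (P ∪ ⁅ a ⁆)
  w = ind M (P ∪ ⁅ b ⁆)
  z = ind M P
  parallel : α ≡ true → β ≡ true → γ ≡ false → v ≡ w
  parallel inda indb depab = true⇔true⇒≡ (parallel-exchange indb depab a∉P b∉P)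
    (parallel-exchange inda (trans (cong (ind M) (∪-comm ⁅ b ⁆ ⁅ a ⁆)) depab) b∉P a∉P)

indContract-contraction : ∀ {M : Matroid (suc n)} {f N} → ContractsTo M f N →
                          ∀ g Y → indContract N g Y ≡ indContract₂ M f (punchIn f g) (image (punchIn f) Y)
indContract-contraction {M = M} {f} contracted g Y = trans
  (if-cong (trans (ind-contract contracted ⁅ g ⁆) (cong (indContract M f) (image-⁅⁆ (punchIn f) g))))
  (if-cong₂ _ (trans (ind-contract contracted (Y ∪ ⁅ g ⁆)) (cong (indContract M f) (image-∪⁅⁆ (punchIn f) Y g)))
              (ind-contract contracted Y))

extendFixing : Fin (suc n) → (Fin n → Fin n) → Fin (suc n) → Fin (suc n)
extendFixing f σ j with f ≟ j
... | yes _   = f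
... | no  f≢j = punchIn f (σ (punchOut f≢j))

extendFixing-fixes : ∀ (f : Fin (suc n)) σ → extendFixing f σ f ≡ f
extendFixing-fixes f σ with f ≟ f
... | yes _   = refl
... | no  f≢f = contradiction refl f≢f

extendFixing-punchIn : ∀ (f : Fin (suc n)) σ i → extendFixing f σ (punchIn f i) ≡ punchIn f (σ i)
extendFixing-punchIn f σ i with f ≟ punchIn f i
... | yes f≡ = contradiction (sym f≡) (Finₚ.punchInᵢ≢i f i)
... | no  f≢ = cong (punchIn f ∘ σ) (trans (Finₚ.punchOut-cong f refl) (Finₚ.punchOut-punchIn f))

extendFixing-injective : ∀ (f : Fin (suc n)) {σ} → Injective _≡_ _≡_ σ → Injective _≡_ _≡_ (extendFixing f σ)
extendFixing-injective f {σ} inj {i} {j} eq with f ≟ i | f ≟ j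
... | yes f≡i | yes f≡j = trans (sym f≡i) f≡j
... | yes _   | no  _   = contradiction (sym eq) (Finₚ.punchInᵢ≢i f _)
... | no  _   | yes _   = contradiction eq (Finₚ.punchInᵢ≢i f _)
... | no  f≢i | no  f≢j = Finₚ.punchOut-injective f≢i f≢j (inj (punchIn-injective′ f eq))

punchIn-swap : ∀ (f : Fin (suc (suc n))) g (g′≢f : punchIn f g ≢ f) i →
               punchIn (punchIn f g) (punchIn (punchOut g′≢f) i) ≡ punchIn f (punchIn g i)
punchIn-swap zero    g       _    i       = refl
punchIn-swap (suc f) zero    _    i       = refl
punchIn-swap {suc n} (suc f) (suc g) _ zero = refl
punchIn-swap {suc n} (suc f) (suc g) g′≢f (suc i) = cong suc (punchIn-swap f g (g′≢f ∘ cong suc) i)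

-- Removing g′ and then f′ is removing f and then g.
module Swap (f : Fin (suc (suc n))) (g : Fin (suc n)) where

  g′ : Fin (suc (suc n))
  g′ = punchIn f g

  g′≢f : g′ ≢ f
  g′≢f = Finₚ.punchInᵢ≢i f g

  f′ : Fin (suc n)
  f′ = punchOut g′≢f

  punchIn-g′-f′ : punchIn g′ f′ ≡ f
  punchIn-g′-f′ = Finₚ.punchIn-punchOut g′≢f

  image-swap : ∀ X → image (punchIn g′) (image (punchIn f′) X) ≡ image (punchIn f) (image (punchIn g) X)
  image-swap = image-square {g = punchIn g′} {punchIn f′} {punchIn f} {punchIn g} (punchIn-swap f g g′≢f)

  indContract-swap : ∀ (M : Matroid (suc (suc n))) X →
    indContract M (punchIn g′ f′) (image (punchIn g′) (image (punchIn f′) X)) ≡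
    indContract M f (image (punchIn f) (image (punchIn g) X))
  indContract-swap M X = cong₂ (indContract M) punchIn-g′-f′ (image-swap X)

  indContract₂-swap : ∀ (M : Matroid (suc (suc n))) X →
    indContract₂ M g′ (punchIn g′ f′) (image (punchIn g′) (image (punchIn f′) X)) ≡
    indContract₂ M g′ f (image (punchIn f) (image (punchIn g) X))
  indContract₂-swap M X = cong₂ (indContract₂ M g′) punchIn-g′-f′ (image-swap X)

lift-cStarTransformation : ∀ {M : Matroid m} {M′ : Matroid n} → Minor M M′ →
  ∀ {M⁺ : Matroid (suc n)} {f M″} → IsPullback M⁺ (punchIn f) M′ → ContractsTo M⁺ f M″ →
  Σ (Matroid m) λ M₀ → IsCStarTransformation M M₀ × Minor M₀ M″
lift-cStarTransformation {M = M} {M′} (minor-iso iso) {M⁺} {f} {M″} deleted contracted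
  with Isomorphic⇒IsPullback {M = M} {M′} iso
... | σ , inj , pb =
  M₀ , (M⁺₀ , f , IsPullback⇒IsDeletion deleted₀ , ContractsTo⇒IsContraction contracted₀) ,
  minor-iso (IsPullback⇒Isomorphic {M = M₀} {M″} (pullback-isPullback M″ σ inj) inj)
  where
  σ⁺ = extendFixing f σ
  inj⁺ = extendFixing-injective f inj
  M⁺₀ = pullback M⁺ σ⁺ inj⁺
  M₀ = pullback M″ σ inj
  deleted₀ : IsPullback M⁺₀ (punchIn f) M
  deleted₀ = IsPullback-factor inj⁺ (IsPullback-cong (sym ∘ extendFixing-punchIn f σ) (IsPullback-∘ deleted pb))
  contracted₀ : ContractsTo M⁺₀ f M₀
  contracted₀ = mkContractsTo λ X → begin
    ind M″ (image σ X)
      ≡⟨ ind-contract contracted (image σ X) ⟩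
    indContract M⁺ f (image (punchIn f) (image σ X))
      ≡⟨ cong₂ (indContract M⁺) (extendFixing-fixes f σ)
               (image-square {g = σ⁺} {punchIn f} {punchIn f} {σ} (extendFixing-punchIn f σ) X) ⟨
    indContract M⁺ (σ⁺ f) (image σ⁺ (image (punchIn f) X))
      ≡⟨ indContract-pullback (pullback-isPullback M⁺ σ⁺ inj⁺) f (image (punchIn f) X) ⟨
    indContract M⁺₀ f (image (punchIn f) X)
      ∎
    where open ≡-Reasoning
lift-cStarTransformation {n = suc _} (minor-del g N deletedM′ M≤N) {M⁺} {f} {M″} deleted contracted =
  let (M₀ , transformation , M₀≤) = lift-cStarTransformation M≤N deleted₁ contracted₁
  in M₀ , transformation , minor-del g (deletion M″ g) (deletion-isDeletion M″ g) M₀≤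
  where
  open Swap f g
  deleted₁ : IsPullback (deletion M⁺ g′) (punchIn f′) N
  deleted₁ = IsPullback-factor (punchIn-injective′ g′)
    (IsPullback-cong (sym ∘ punchIn-swap f g g′≢f) (IsPullback-∘ deleted (IsDeletion⇒IsPullback deletedM′)))
  contracted₁ : ContractsTo (deletion M⁺ g′) f′ (deletion M″ g)
  contracted₁ = mkContractsTo λ X → begin
    ind M″ (image (punchIn g) X)
      ≡⟨ ind-contract contracted (image (punchIn g) X) ⟩
    indContract M⁺ f (image (punchIn f) (image (punchIn g) X))
      ≡⟨ indContract-swap M⁺ X ⟨
    indContract M⁺ (punchIn g′ f′) (image (punchIn g′) (image (punchIn f′) X))
      ≡⟨ indContract-pullback (pullback-isPullback M⁺ _ (punchIn-injective′ g′)) f′ (image (punchIn f′) X) ⟨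
    indContract (deletion M⁺ g′) f′ (image (punchIn f′) X)
      ∎
    where open ≡-Reasoning
lift-cStarTransformation {n = suc _} {M′ = M′} (minor-con g N contractedM′ M≤N) {M⁺} {f} {M″} deleted contracted =
  let (M₀ , transformation , M₀≤) = lift-cStarTransformation M≤N deleted₁ contracted₁
  in M₀ , transformation , minor-con g (contraction M″ g) (contraction-isContraction M″ g) M₀≤
  where
  open Swap f g
  open ≡-Reasoning
  deleted₁ : IsPullback (contraction M⁺ g′) (punchIn f′) N
  deleted₁ = mkPullback λ X → begin
    ind N X
      ≡⟨ ind-contract (IsContraction⇒ContractsTo {M = M′} {g} {N} contractedM′) X ⟩
    indContract M′ g (image (punchIn g) X)
      ≡⟨ indContract-pullback deleted g (image (punchIn g) X) ⟩
    indContract M⁺ g′ (image (punchIn f) (image (punchIn g) X))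
      ≡⟨ cong (indContract M⁺ g′) (image-swap X) ⟨
    indContract M⁺ g′ (image (punchIn g′) (image (punchIn f′) X))
      ∎
  g′∉ : ∀ {X} → g′ ∉ image (punchIn f) (image (punchIn g) X)
  g′∉ {X} = subst (g′ ∉_) (image-swap X) (f∉image-punchIn g′ (image (punchIn f′) X))
  contracted₁ : ContractsTo (contraction M⁺ g′) f′ (contraction M″ g)
  contracted₁ = mkContractsTo λ X → begin
    indContract M″ g (image (punchIn g) X)
      ≡⟨ indContract-contraction contracted g (image (punchIn g) X) ⟩
    indContract₂ M⁺ f g′ (image (punchIn f) (image (punchIn g) X))
      ≡⟨ indContract₂-comm M⁺ (f∉image-punchIn f (image (punchIn g) X)) (g′∉ {X}) ⟩
    indContract₂ M⁺ g′ f (image (punchIn f) (image (punchIn g) X))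
      ≡⟨ indContract₂-swap M⁺ X ⟨
    indContract₂ M⁺ g′ (punchIn g′ f′) (image (punchIn g′) (image (punchIn f′) X))
      ≡⟨ indContract-contraction (contraction-contractsTo M⁺ g′) f′ (image (punchIn f′) X) ⟨
    indContract (contraction M⁺ g′) f′ (image (punchIn f′) X)
      ∎

-- Connected minors lie in a component

-- L is ⊥ for a pullback, and ⁅ g ⁆ or ⊥ for a contraction at g.
circuit-lift : ∀ {M : Matroid n} {N : Matroid m} {e L} →
  (∀ X → ind N X ≡ ind M (image e X ∪ L)) → ∀ {D} → IsCircuit N D → ∃[ C ] (IsCircuit M C × image e D ⊆ C)
circuit-lift {M = M} {N} {e} {L} indN≡ {D} (depD , minimal) =
  let (C , circC , C⊆) = circuit⊆dependent (trans (sym (indN≡ D)) depD) in C , circC , eD⊆ circC C⊆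
  where
  open Properties M
  shrink : ∀ {C i} → C ⊆ image e D ∪ L → e i ∉ C → C ⊆ image e (D - i) ∪ L
  shrink {C} {i} C⊆ ei∉C c∈C with x∈p∪q⁻ _ L (C⊆ c∈C)
  ... | inj₂ c∈L = q⊆p∪q _ L c∈L
  ... | inj₁ c∈eD with ∈-image⁻ e D c∈eD
  ...   | j , j∈D , refl = p⊆p∪q L (∈-image⁺ e (D - i) (x∈p∧x≢y⇒x∈p-y j∈D λ { refl → ei∉C c∈C }))
  eD⊆ : ∀ {C} → IsCircuit M C → C ⊆ image e D ∪ L → image e D ⊆ C
  eD⊆ {C} circC C⊆ y∈ with ∈-image⁻ e D y∈
  ... | i , i∈D , refl with e i ∈? C
  ...   | yes ei∈C = ei∈C
  ...   | no  ei∉C = contradiction (independent-⊆ (shrink C⊆ ei∉C) (trans (sym (indN≡ (D - i))) D-i-independent))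
                                   (circuit-¬independent circC)
    where
    D-i-independent : ind N (D - i) ≡ true
    D-i-independent = minimal (D - i) (x∈p⇒p-x⊂p i∈D)

clique-lift : ∀ {M : Matroid n} {N : Matroid m} {e L} →
  (∀ X → ind N X ≡ ind M (image e X ∪ L)) → ∀ {C} → CircuitClique N C → CircuitClique M (image e C)
clique-lift {M = M} {N} {e} {L} indN≡ {C} clique x y x∈ y∈ x≢y with ∈-image⁻ e C x∈ | ∈-image⁻ e C y∈
... | i , i∈C , refl | j , j∈C , refl =
  let (D , circD , i∈D , j∈D) = clique i j i∈C j∈C (x≢y ∘ cong e)
      (D′ , circD′ , eD⊆D′) = circuit-lift {M = M} {N} {e} {L} indN≡ circD
  in D′ , circD′ , eD⊆D′ (∈-image⁺ e D i∈D) , eD⊆D′ (∈-image⁺ e D j∈D)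

IsPullback⇒ind-∪⊥ : ∀ {M : Matroid n} {N : Matroid m} {e} → IsPullback M e N →
                    ∀ X → ind N X ≡ ind M (image e X ∪ ⊥)
IsPullback⇒ind-∪⊥ {M = M} pb X = trans (ind-pullback pb X) (cong (ind M) (sym (∪-identityʳ _)))

ContractsTo⇒ind-∪ : ∀ {M : Matroid (suc n)} {g N} → ContractsTo M g N →
                    ∃[ L ] (∀ X → ind N X ≡ ind M (image (punchIn g) X ∪ L))
ContractsTo⇒ind-∪ {M = M} {g} contracted with ind M ⁅ g ⁆ in indg
... | true  = ⁅ g ⁆ , λ X → trans (ind-contract contracted X) (if-cong indg)
... | false = ⊥ , λ X →
  trans (ind-contract contracted X) (trans (if-cong indg) (cong (ind M) (sym (∪-identityʳ _))))

component-separator : ∀ {M : Matroid n} {K g Z} → IsComponent M K → g ∉ K → ind M ⁅ g ⁆ ≡ true → Z ⊆ K →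
                      ind M (Z ∪ ⁅ g ⁆) ≡ ind M Z
component-separator {M = M} {K} {g} {Z} isComp g∉K indg Z⊆K =
  true⇔true⇒≡ (independent-⊆ (p⊆p∪q ⁅ g ⁆)) independent-∪⁅g⁆
  where
  open Properties M
  independent-∪⁅g⁆ : Independent Z → Independent (Z ∪ ⁅ g ⁆)
  independent-∪⁅g⁆ indZ with ind M (Z ∪ ⁅ g ⁆) in indZg
  ... | true  = refl
  ... | false with circuit⊆dependent indZg
  ...   | C , circC , C⊆ with g ∈? C | Finₚ.any? (λ y → y ∈? C ×-dec ¬? (y ≟ g))
  ...     | no g∉C | _ = contradiction (independent-⊆ C⊆Z indZ) (circuit-¬independent circC)
    where
    C⊆Z : C ⊆ Z
    C⊆Z c∈C = x∈p∪q∧x∉q⇒x∈p Z ⁅ g ⁆ (C⊆ c∈C) (x≢y⇒x∉⁅y⁆ λ { refl → g∉C c∈C })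
  ...     | yes _ | no ∄y = contradiction (independent-⊆ C⊆⁅g⁆ indg) (circuit-¬independent circC)
    where
    C⊆⁅g⁆ : C ⊆ ⁅ g ⁆
    C⊆⁅g⁆ {c} c∈C with c ≟ g
    ... | yes refl = x∈⁅x⁆ c
    ... | no  c≢g  = contradiction (c , c∈C , c≢g) ∄y
  ...     | yes g∈C | yes (y , y∈C , y≢g) =
    contradiction (component-≈-closed isComp (Z⊆K y∈Z) (C , circC , g∈C , y∈C)) g∉K
    where
    y∈Z : y ∈ Z
    y∈Z = x∈p∪q∧x∉q⇒x∈p Z ⁅ g ⁆ (C⊆ y∈C) (x≢y⇒x∉⁅y⁆ y≢g)

ContractsTo-away-from-component : ∀ {M : Matroid (suc n)} {g N K} → ContractsTo M g N → IsComponent M K → g ∉ K →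
  ∀ Y → image (punchIn g) Y ⊆ K → ind N Y ≡ ind M (image (punchIn g) Y)
ContractsTo-away-from-component {M = M} {g} contracted isComp g∉K Y gY⊆K
  with ind M ⁅ g ⁆ in indg | ind-contract contracted Y
... | true  | indN≡ = trans indN≡ (component-separator {M = M} isComp g∉K indg gY⊆K)
... | false | indN≡ = indN≡

-- Q is in fact a minor of P / gₚ.
contraction-through⇒Minor : ∀ {M : Matroid (suc n)} {g N} {P : Matroid m} {τ} → ContractsTo M g N →
  IsPullback M τ P → Injective _≡_ _≡_ τ → ∀ gₚ → τ gₚ ≡ g →
  ∀ {Q : Matroid p} {e} → IsPullback N e Q → Injective _≡_ _≡_ e → (∀ i → ∃[ j ] (τ j ≡ punchIn g (e i))) →
  Minor Q P
contraction-through⇒Minor {m = zero} _ _ _ () _ _ _ _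
contraction-through⇒Minor {m = suc _} {N = N} {P} {τ} contracted pbP τ-inj gₚ refl {e = e} pbQ e-inj through =
  minor-trans (pullback-through⇒Minor pb pbQ e-inj through′)
              (minor-con gₚ (contraction P gₚ) (contraction-isContraction P gₚ) minor-refl)
  where
  avoids = injective-avoids τ-inj gₚ
  pb : IsPullback N (squeeze avoids) (contraction P gₚ)
  pb = IsPullback-contraction τ-inj pbP (contraction-contractsTo P gₚ) contracted
  through′ : ∀ i → ∃[ j ] (squeeze avoids j ≡ e i)
  through′ i with through i
  ... | j , τj≡ with gₚ ≟ j
  ...   | yes refl = contradiction (sym τj≡) (Finₚ.punchInᵢ≢i (τ gₚ) (e i))
  ...   | no  gₚ≢j = punchOut gₚ≢j , punchIn-injective′ (τ gₚ) (begin
    punchIn (τ gₚ) (squeeze avoids (punchOut gₚ≢j))  ≡⟨ punchIn-squeeze avoids (punchOut gₚ≢j) ⟩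
    τ (punchIn gₚ (punchOut gₚ≢j))                   ≡⟨ cong τ (Finₚ.punchIn-punchOut gₚ≢j) ⟩
    τ j                                              ≡⟨ τj≡ ⟩
    punchIn (τ gₚ) (e i)                             ∎)
    where open ≡-Reasoning

∈-component-lift : ∀ {M′ : Matroid (suc n)} {N : Matroid n} {g L} →
  (∀ X → ind N X ≡ ind M′ (image (punchIn g) X ∪ L)) → ∀ {C} → IsComponent N C → ∀ {c x} → c ∈ C → x ∈ C →
  punchIn g x ∈ Properties.component M′ (punchIn g c)
∈-component-lift {M′ = M′} {N} {g} {L} indN≡ (clique , _) c∈C x∈C =
  clique⊆component (clique-lift {M = M′} {N} {punchIn g} {L} indN≡ clique)
                   (∈-image⁺ (punchIn g) _ c∈C) (∈-image⁺ (punchIn g) _ x∈C)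
  where open Properties M′

connected-minor-in-component : ∀ {M : Matroid m} {M′ : Matroid n} → Minor M M′ → CircuitClique M ⊤ → Fin m →
                               ∃[ K ] (IsComponent M′ K × Minor M (restriction M′ K))
connected-minor-in-component {M = M} {M′} (minor-iso iso) clique x₀ with Isomorphic⇒IsPullback {M = M} {M′} iso
... | σ , inj , pb = K , component-isComponent (σ x₀) , pullback-inside⇒Minor K pb inj σ∈K
  where
  open Properties M′
  K = component (σ x₀)
  σ∈K : ∀ i → σ i ∈ K
  σ∈K i = clique⊆component (clique-lift {M = M′} {M} {σ} {⊥} (IsPullback⇒ind-∪⊥ pb) clique)
                           (∈-image⁺ σ ⊤ ∈⊤) (∈-image⁺ σ ⊤ ∈⊤)
connected-minor-in-component {M′ = M′} (minor-del g N deleted M≤N) clique x₀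
  with connected-minor-in-component M≤N clique x₀
... | C , isCompC , M≤NC =
  K , component-isComponent (punchIn g c₀) , minor-trans M≤NC (pullback-inside⇒Minor K pb e-inj e∈K)
  where
  open Properties M′
  pbN = IsDeletion⇒IsPullback {M = M′} {g} {N} deleted
  c₀ = enumerate C (inject≤ x₀ (minor-size M≤NC))
  K = component (punchIn g c₀)
  e∈K : ∀ i → punchIn g (enumerate C i) ∈ K
  e∈K i = ∈-component-lift {M′ = M′} {N} (IsPullback⇒ind-∪⊥ pbN) isCompC (enumerate-∈ C _) (enumerate-∈ C i)
  e-inj : Injective _≡_ _≡_ (punchIn g ∘ enumerate C)
  e-inj eq = enumerate-injective C (punchIn-injective′ g eq)
  pb : IsPullback M′ (punchIn g ∘ enumerate C) (restriction N C)
  pb = IsPullback-∘ pbN (restriction-isPullback N C)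
connected-minor-in-component {M′ = M′} (minor-con g N contracted M≤N) clique x₀
  with connected-minor-in-component M≤N clique x₀
... | C , isCompC , M≤NC =
  K , component-isComponent (punchIn g c₀) , minor-trans M≤NC (restricted-minor (g ∈? K))
  where
  open Properties M′
  contractedN = IsContraction⇒ContractsTo {M = M′} {g} {N} contracted
  c₀ = enumerate C (inject≤ x₀ (minor-size M≤NC))
  K = component (punchIn g c₀)
  e∈K : ∀ i → punchIn g (enumerate C i) ∈ K
  e∈K i = ∈-component-lift {M′ = M′} {N} (proj₂ (ContractsTo⇒ind-∪ contractedN)) isCompC
                           (enumerate-∈ C _) (enumerate-∈ C i)
  restricted-minor : Dec (g ∈ K) → Minor (restriction N C) (restriction M′ K)
  restricted-minor (yes g∈K) =
    let (gₚ , gₚ↦g) = enumerate-onto K g∈K in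
    contraction-through⇒Minor contractedN (restriction-isPullback M′ K) (enumerate-injective K) gₚ gₚ↦g
      (restriction-isPullback N C) (enumerate-injective C) (enumerate-onto K ∘ e∈K)
  restricted-minor (no g∉K) = pullback-inside⇒Minor K pb e-inj e∈K
    where
    e-inj : Injective _≡_ _≡_ (punchIn g ∘ enumerate C)
    e-inj eq = enumerate-injective C (punchIn-injective′ g eq)
    pb : IsPullback M′ (punchIn g ∘ enumerate C) (restriction N C)
    pb = mkPullback λ X → trans
      (ContractsTo-away-from-component contractedN (component-isComponent (punchIn g c₀)) g∉K
        (image (enumerate C) X) (subst (_⊆ K) (image-∘ (punchIn g) (enumerate C) X) (image-⊆ e∈K X)))
      (cong (ind M′) (sym (image-∘ (punchIn g) (enumerate C) X)))

-- c*-depth is minor-monotone and bounded by c-depth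

csd-positive : ∀ {M : Matroid n} {k} → CsdLe M k → 1 ≤ k
csd-positive (csd-small _ 1≤k) = 1≤k
csd-positive {M = M} (csd-disc 2≤n _ components) =
  csd-positive (components (component x₀) (component-isComponent x₀) _ (restriction M (component x₀))
                           (restriction-isRestriction M (component x₀)))
  where
  open Properties M
  x₀ = fromℕ< 2≤n
csd-positive (csd-conn _ _ _ _ _ _) = s≤s z≤n

csd-suc : ∀ {M : Matroid n} {k} → CsdLe M k → CsdLe M (suc k)
csd-suc (csd-small n≤1 1≤k) = csd-small n≤1 (ℕₚ.m≤n⇒m≤1+n 1≤k)
csd-suc (csd-disc 2≤n disconnected components) =
  csd-disc 2≤n disconnected λ C isComp q N restricted → csd-suc (components C isComp q N restricted)
csd-suc (csd-conn 2≤n connected M″ transformation M″≉M d) =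
  csd-conn 2≤n connected M″ transformation M″≉M (csd-suc d)

sameMatroid? : ∀ (A B : Matroid n) → Dec (SameMatroid A B)
sameMatroid? A B with anySubset? (λ X → ¬? (ind A X ≟ᵇ ind B X))
... | yes (X , A≢B) = no λ same → A≢B (same X)
... | no ∄X = yes λ X → decidable-stable (ind A X ≟ᵇ ind B X) λ A≢B → ∄X (X , A≢B)

avoiding-injection⇒< : ∀ {g : Fin m → Fin n} {x} → Injective _≡_ _≡_ g → (∀ i → x ≢ g i) → m < n
avoiding-injection⇒< {n = suc _} inj x∉g = s≤s (Finₚ.injective⇒≤ (squeeze-injective x∉g inj))

csd-from-connected-minors : ∀ {M′ : Matroid n} {k} → 1 ≤ k →
  (∀ {m} (M : Matroid m) → Minor M M′ → 2 ≤ m → Connected M → CsdLe M k) →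
  ∀ {m} (M : Matroid m) → Minor M M′ → CsdLe M k
csd-from-connected-minors {M′ = M′} {k} 1≤k connected-case M = go (<-wellFounded _) M
  where
  go : ∀ {m} → Acc _<_ m → (M : Matroid m) → Minor M M′ → CsdLe M k
  go {m} (acc smaller) M M≤M′ with m ≤? 1 | Properties.connected? M
  ... | yes m≤1 | _          = csd-small m≤1 1≤k
  ... | no  m≰1 | yes conn   = connected-case M M≤M′ (ℕₚ.≰⇒> m≰1) conn
  ... | no  m≰1 | no disconn = csd-disc (ℕₚ.≰⇒> m≰1) disconn λ C isComp q N restricted →
    let (g , inj , g∈C , pb) = IsRestriction⇒IsPullback restricted
        (x , x∉C) = Properties.component-misses M disconn isComp
        x∉g : ∀ i → x ≢ g i
        x∉g i x≡gi = x∉C (subst (_∈ C) (sym x≡gi) (g∈C i))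
    in go (smaller (avoiding-injection⇒< inj x∉g)) N (minor-trans (pullback⇒Minor pb inj) M≤M′)

csd-minor-mono : ∀ {M′ : Matroid n} {k} → CsdLe M′ k → ∀ {m} (M : Matroid m) → Minor M M′ → CsdLe M k
csd-minor-mono (csd-small n≤1 1≤k) = csd-from-connected-minors 1≤k λ M M≤M′ 2≤m _ →
  contradiction (ℕₚ.≤-trans 2≤m (ℕₚ.≤-trans (minor-size M≤M′) n≤1)) λ { (s≤s ()) }
csd-minor-mono {M′ = M′} d@(csd-disc _ _ components) =
  csd-from-connected-minors (csd-positive d) λ M M≤M′ 2≤m conn →
  let (K , isComp , M≤M′∣K) = connected-minor-in-component M≤M′ (Properties.connected⇒clique M conn)
                                                            (fromℕ< 2≤m)
  in csd-minor-mono (components K isComp _ (restriction M′ K) (restriction-isRestriction M′ K)) M M≤M′∣K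
csd-minor-mono {M′ = M′} {suc k} (csd-conn _ _ M″ (M⁺ , f , deleted , contracted) _ d) =
  csd-from-connected-minors (s≤s z≤n) connected-case
  where
  connected-case : ∀ {m} (M : Matroid m) → Minor M M′ → 2 ≤ m → Connected M → CsdLe M (suc k)
  connected-case M M≤M′ 2≤m conn
    with lift-cStarTransformation M≤M′ (IsDeletion⇒IsPullback {M = M⁺} {f} {M′} deleted)
                                       (IsContraction⇒ContractsTo {M = M⁺} {f} {M″} contracted)
  ... | M₀ , transformation , M₀≤M″ with sameMatroid? M₀ M
  ...   | yes M₀≈M = csd-suc (csd-minor-mono d M (minor-trans (SameMatroid⇒Minor (sym ∘ M₀≈M)) M₀≤M″))
  ...   | no  M₀≉M = csd-conn 2≤m conn M₀ transformation M₀≉M (csd-minor-mono d M₀ M₀≤M″)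

module ParallelExtension (M : Matroid n) (e : Fin n) where

  -- The new element zero is parallel to e.

  ind⁺ : Subset (suc n) → Bool
  ind⁺ (outside ∷ X) = ind M X
  ind⁺ (inside  ∷ X) = not (does (e ∈? X)) ∧ ind M (X ∪ ⁅ e ⁆)

  ∉∧≡ : ∀ {X} b → e ∉ X → not (does (e ∈? X)) ∧ b ≡ b
  ∉∧≡ {X} b e∉X with e ∈? X
  ... | yes e∈X = contradiction e∈X e∉X
  ... | no  _   = refl

  ind⁺-inside⁻ : ∀ {X} → ind⁺ (inside ∷ X) ≡ true → e ∉ X × ind M (X ∪ ⁅ e ⁆) ≡ true
  ind⁺-inside⁻ {X} indX with e ∈? X
  ... | yes _   = contradiction indX λ ()
  ... | no  e∉X = e∉X , indX

  ind⁺-inside⁺ : ∀ {X} → e ∉ X → ind M (X ∪ ⁅ e ⁆) ≡ true → ind⁺ (inside ∷ X) ≡ true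
  ind⁺-inside⁺ e∉X indXe = trans (∉∧≡ _ e∉X) indXe

  down⁺ : ∀ X Y → X ⊆ Y → ind⁺ Y ≡ true → ind⁺ X ≡ true
  down⁺ (outside ∷ X) (outside ∷ Y) X⊆Y indY = ind-down M X Y (drop-∷-⊆ X⊆Y) indY
  down⁺ (outside ∷ X) (inside  ∷ Y) X⊆Y indY =
    ind-down M X (Y ∪ ⁅ e ⁆) (p⊆p∪q ⁅ e ⁆ ∘ drop-∷-⊆ X⊆Y) (proj₂ (ind⁺-inside⁻ indY))
  down⁺ (inside  ∷ X) (outside ∷ Y) X⊆Y _ with () ← X⊆Y here
  down⁺ (inside  ∷ X) (inside  ∷ Y) X⊆Y indY =
    let (e∉Y , indYe) = ind⁺-inside⁻ indY
    in ind⁺-inside⁺ (e∉Y ∘ drop-∷-⊆ X⊆Y) (ind-down M _ _ (∪-monoˡ-⊆ ⁅ e ⁆ (drop-∷-⊆ X⊆Y)) indYe)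

  ∣∪⁅e⁆∣ : ∀ {X} → ind⁺ (inside ∷ X) ≡ true → ∣ X ∪ ⁅ e ⁆ ∣ ≡ suc ∣ X ∣
  ∣∪⁅e⁆∣ {X} indX = ∣p∪⁅x⁆∣≡1+∣p∣ X e (proj₁ (ind⁺-inside⁻ indX))

  extend-inside : ∀ {X y} → e ∉ X → y ∉ X ∪ ⁅ e ⁆ → ind M ((X ∪ ⁅ e ⁆) ∪ ⁅ y ⁆) ≡ true →
                  ind⁺ (inside ∷ (X ∪ ⁅ y ⁆)) ≡ true
  extend-inside {X} {y} e∉X y∉Xe indXey = ind⁺-inside⁺ e∉Xy (trans (cong (ind M) (∪-swapʳ X ⁅ y ⁆ ⁅ e ⁆)) indXey)
    where
    e∉Xy : e ∉ X ∪ ⁅ y ⁆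
    e∉Xy e∈Xy with x∈p∪⁅y⁆⁻ X e∈Xy
    ... | inj₁ e∈X  = e∉X e∈X
    ... | inj₂ refl = y∉Xe (y∈p∪⁅y⁆ X e)

  aug⁺ : ∀ X Y → ind⁺ X ≡ true → ind⁺ Y ≡ true → ∣ X ∣ < ∣ Y ∣ →
         ∃[ y ] (y ∈ Y × y ∉ X × ind⁺ (X ∪ ⁅ y ⁆) ≡ true)
  aug⁺ (outside ∷ X) (outside ∷ Y) indX indY ∣X∣<∣Y∣ =
    let (y , y∈Y , y∉X , indXy) = ind-aug M X Y indX indY ∣X∣<∣Y∣ in suc y , there y∈Y , y∉X ∘ drop-there , indXy
  aug⁺ (outside ∷ X) (inside ∷ Y) indX indY ∣X∣<∣Y∣
    with ind-aug M X (Y ∪ ⁅ e ⁆) indX (proj₂ (ind⁺-inside⁻ indY)) (subst (∣ X ∣ <_) (sym (∣∪⁅e⁆∣ indY)) ∣X∣<∣Y∣)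
  ... | y , y∈Ye , y∉X , indXy with x∈p∪⁅y⁆⁻ Y y∈Ye
  ...   | inj₁ y∈Y  = suc y , there y∈Y , y∉X ∘ drop-there , indXy
  ...   | inj₂ refl = zero , here , (λ ()) ,
                      subst (λ Z → ind⁺ (inside ∷ Z) ≡ true) (sym (∪-identityʳ X)) (ind⁺-inside⁺ y∉X indXy)
  aug⁺ (inside ∷ X) (outside ∷ Y) indX indY ∣X∣<∣Y∣
    with ind-aug M (X ∪ ⁅ e ⁆) Y (proj₂ (ind⁺-inside⁻ indX)) indY (subst (_< ∣ Y ∣) (sym (∣∪⁅e⁆∣ indX)) ∣X∣<∣Y∣)
  ... | y , y∈Y , y∉Xe , indXey =
    suc y , there y∈Y , y∉Xe ∘ p⊆p∪q ⁅ e ⁆ ∘ drop-there , extend-inside (proj₁ (ind⁺-inside⁻ indX)) y∉Xe indXey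
  aug⁺ (inside ∷ X) (inside ∷ Y) indX indY ∣X∣<∣Y∣
    with ind-aug M (X ∪ ⁅ e ⁆) (Y ∪ ⁅ e ⁆) (proj₂ (ind⁺-inside⁻ indX)) (proj₂ (ind⁺-inside⁻ indY))
                 (subst₂ _<_ (sym (∣∪⁅e⁆∣ indX)) (sym (∣∪⁅e⁆∣ indY)) ∣X∣<∣Y∣)
  ... | y , y∈Ye , y∉Xe , indXey with x∈p∪⁅y⁆⁻ Y y∈Ye
  ...   | inj₂ refl = contradiction (y∈p∪⁅y⁆ X y) y∉Xe
  ...   | inj₁ y∈Y  =
    suc y , there y∈Y , y∉Xe ∘ p⊆p∪q ⁅ e ⁆ ∘ drop-there , extend-inside (proj₁ (ind⁺-inside⁻ indX)) y∉Xe indXey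

  parallelExtension : Matroid (suc n)
  parallelExtension = record { ind = ind⁺ ; ind-empty = ind-empty M ; ind-down = down⁺ ; ind-aug = aug⁺ }

constant-injective⇒≤1 : ∀ {g : Fin m → Fin n} {c} → Injective _≡_ _≡_ g → (∀ i → g i ≡ c) → m ≤ 1
constant-injective⇒≤1 {g = g} inj g≡c =
  Finₚ.injective⇒≤ {f = λ (_ : Fin _) → zero {n = 0}} λ {i} {j} _ → inj (trans (g≡c i) (sym (g≡c j)))

csd-via-parallelExtension : ∀ {M : Matroid (suc n)} {k} → 1 ≤ n → Connected M →
  ∀ e {N} → IsContraction M e N → CsdLe N k → CsdLe M (suc k)
csd-via-parallelExtension {suc n} {M} {k} _ conn e {N} contracted dN =
  csd-conn (s≤s (s≤s z≤n)) conn M″ transformation M″≉M (csd-disc (s≤s (s≤s z≤n)) M″-disconnected components)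
  where
  open ParallelExtension M e
  open Properties using (loop-≉; connected⇒clique)
  x = punchIn e zero
  x≢e : x ≢ e
  x≢e = Finₚ.punchInᵢ≢i e zero
  e-nonloop : ind M ⁅ e ⁆ ≡ true
  e-nonloop = ¬-not λ loop → loop-≉ M loop x≢e (connected⇒clique M conn e x ∈⊤ ∈⊤ (x≢e ∘ sym))
  M″ = contraction parallelExtension zero
  ind-M″ : ∀ X → ind M″ X ≡ not (does (e ∈? X)) ∧ ind M (X ∪ ⁅ e ⁆)
  zero-nonloop : ind⁺ ⁅ zero ⁆ ≡ true
  zero-nonloop = ind⁺-inside⁺ ∉⊥ (trans (cong (ind M) (∪-identityˡ ⁅ e ⁆)) e-nonloop)
  ind-M″ X = begin
    indContract parallelExtension zero (image (punchIn zero) X)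
      ≡⟨ cong (indContract parallelExtension zero) (image-punchIn-zero X) ⟩
    indContract parallelExtension zero (outside ∷ X)
      ≡⟨ if-cong zero-nonloop ⟩
    ind⁺ (inside ∷ (X ∪ ⊥))
      ≡⟨ cong (ind⁺ ∘ (inside ∷_)) (∪-identityʳ X) ⟩
    ind⁺ (inside ∷ X)
      ∎
    where open ≡-Reasoning
  transformation : IsCStarTransformation M M″
  transformation = parallelExtension , zero ,
    IsPullback⇒IsDeletion {M = parallelExtension} {zero} {M}
      (mkPullback λ X → cong ind⁺ (sym (image-punchIn-zero X))) ,
    contraction-isContraction parallelExtension zero
  e-loop : ind M″ ⁅ e ⁆ ≡ false
  e-loop = trans (ind-M″ ⁅ e ⁆) (cong (λ b → not b ∧ ind M (⁅ e ⁆ ∪ ⁅ e ⁆)) (dec-true (e ∈? ⁅ e ⁆) (x∈⁅x⁆ e)))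
  M″≉M : ¬ SameMatroid M″ M
  M″≉M same = not-¬ e-nonloop (trans (sym (same ⁅ e ⁆)) e-loop)
  M″-disconnected : ¬ Connected M″
  M″-disconnected conn″ = loop-≉ M″ e-loop x≢e (connected⇒clique M″ conn″ e x ∈⊤ ∈⊤ (x≢e ∘ sym))
  components : ∀ C → IsComponent M″ C → ∀ q (Q : Matroid q) → IsRestriction M″ C Q → CsdLe Q k
  components C isComp q Q restricted with IsRestriction⇒IsPullback {M = M″} {C} {Q} restricted | e ∈? C
  ... | g , inj , g∈C , pb | yes e∈C = csd-small (constant-injective⇒≤1 inj (only-e ∘ g∈C)) (csd-positive dN)
    where
    only-e : ∀ {y} → y ∈ C → y ≡ e
    only-e {y} y∈C with y ≟ e
    ... | yes y≡e = y≡e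
    ... | no  y≢e = contradiction (proj₁ isComp e y e∈C y∈C (y≢e ∘ sym)) (loop-≉ M″ e-loop y≢e)
  ... | g , inj , g∈C , pb | no e∉C = csd-minor-mono dN Q (pullback⇒Minor pbN (squeeze-injective e∉g inj))
    where
    e∉g : ∀ i → e ≢ g i
    e∉g i e≡gi = e∉C (subst (_∈ C) (sym e≡gi) (g∈C i))
    pbN : IsPullback N (squeeze e∉g) Q
    pbN = mkPullback λ X → begin
      ind Q X                                                  ≡⟨ ind-pullback pb X ⟩
      ind M″ (image g X)                                       ≡⟨ ind-M″ (image g X) ⟩
      not (does (e ∈? image g X)) ∧ ind M (image g X ∪ ⁅ e ⁆)  ≡⟨ ∉∧≡ _ (e∉C ∘ image-⊆ g∈C X) ⟩
      ind M (image g X ∪ ⁅ e ⁆)                                ≡⟨ if-cong e-nonloop ⟨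
      indContract M e (image g X)                              ≡⟨ cong (indContract M e) (image-squeeze e∉g X) ⟨
      indContract M e (image (punchIn e) (image (squeeze e∉g) X)) ≡⟨ contracted _ _ (Img-image _ _) ⟨
      ind N (image (squeeze e∉g) X)                            ∎
      where open ≡-Reasoning

cd⇒csd : ∀ {M : Matroid n} {k} → CdLe M k → CsdLe M k
cd⇒csd (cd-small n≤1 1≤k) = csd-small n≤1 1≤k
cd⇒csd (cd-disc 2≤n disconnected components) =
  csd-disc 2≤n disconnected λ C isComp q N restricted → cd⇒csd (components C isComp q N restricted)
cd⇒csd (cd-conn 1≤n connected e N contracted d) = csd-via-parallelExtension 1≤n connected e contracted (cd⇒csd d)

mainTheorem9 : ∀ {m n} (M : Matroid m) (M' : Matroid n) → Minor M M' →
                 ((k : ℕ) → CsdLe M' k → CsdLe M k) × ((k : ℕ) → CdLe M' k → CsdLe M' k)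
mainTheorem9 M M' M≤M' = (λ k csd≤k → csd-minor-mono csd≤k M M≤M') , (λ k → cd⇒csd)
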